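{- For every integer $p \ge 1$ and every multiindex $(j_1, \dots, j_{p-1}) \in \{0,1\}^{p-1}$, the coefficient $a^{(p)}_{j_1 \dots j_{p-1}}$ is equal to the number of permutations $\pi$ of $\{1,\dots,p\}$ whose descent set $D(\pi) = \{ i : \pi(i) > \pi(i+1),\ 1 \le i \le p-1\}$ equals $S = \{k : j_k = 1,\ 1 \le k \le p-1\}$.
   Context: Let $\mu_1, \mu_2, \dots$ be indeterminates (or variables taking values different from $1$), and set $\mu_0 = 1$. Define a sequence $e_p = e_p(\mu_1,\dots,\mu_p)$ by $e_0 = 1$ and, for $p \ge 1$, \[ e_p = \frac{1}{1-\mu_p} \sum_{k=0}^{p-1} \binom{p}{k} \mu_k e_k . \] For each $p \ge 1$, the product $(1-\mu_1)\cdots(1-\mu_p)\, e_p$ is a polynomial in $\mu_1, \dots, \mu_{p-1}$ of degree at most one in each variable, so one can write \[ e_p = \frac{1}{(1-\mu_1)\cdots(1-\mu_p)} \sum_{(j_1,\dots,j_{p-1}) \in \{0,1\}^{p-1}} a^{(p)}_{j_1 \dots j_{p-1}} \mu_1^{j_1} \cdots \mu_{p-1}^{j_{p-1}}, \] which defines the coefficients $a^{(p)}_{j_1\dots j_{p-1}}$ (for $p=1$ the index is empty). -}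

module Defs where

open import Data.Nat as ℕ using (ℕ; zero; suc)
open import Data.Nat.Combinatorics using (_C_)
open import Data.Fin as Fin using (Fin; toℕ; inject₁)
open import Data.Fin.Properties using (all?)
open import Data.Bool using (Bool; true; false; if_then_else_)
import Data.Bool.Properties as BoolP
open import Data.List as List using (List; []; _∷_; concatMap; map; filter; length)
open import Data.Vec as Vec using (Vec; []; _∷_; lookup; tabulate)
import Data.Vec.Properties as VecP
open import Data.Rational as ℚ using (ℚ; 0ℚ; 1ℚ; _+_; _*_; _-_; 1/_; _≟_)
open import Data.Rational.Base using (≢-nonZero)
open import Relation.Nullary using (Dec; yes; no; ¬_)
open import Relation.Nullary.Decidable using (_×-dec_; _→-dec_; ⌊_⌋)
open import Relation.Binary.PropositionalEquality using (_≡_)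

-- Convention: the indeterminates are given by values μ : ℕ → ℚ, where
-- μ i stands for μ_i (i ≥ 1).  The value μ 0 is ignored: μ_0 = 1.
μ₀ : (ℕ → ℚ) → ℕ → ℚ
μ₀ μ zero    = 1ℚ
μ₀ μ (suc i) = μ (suc i)

-- Inverse of a rational number (only ever used on nonzero arguments,
-- the hypothesis μ_i ≠ 1 guarantees this; the value 0 at 0 is a dummy).
inv : ℚ → ℚ
inv q with q ≟ 0ℚ
... | yes _ = 0ℚ
... | no q≢0 = 1/_ q {{≢-nonZero q≢0}}

Σ< : (n : ℕ) → (Fin n → ℚ) → ℚ
Σ< zero    f = 0ℚ
Σ< (suc n) f = f Fin.zero + Σ< n (λ k → f (Fin.suc k))

Π1 : (n : ℕ) → (ℕ → ℚ) → ℚ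
Π1 zero    g = 1ℚ
Π1 (suc n) g = Π1 n g * g (suc n)

ℕ→ℚ : ℕ → ℚ
ℕ→ℚ n = ℚ.mkℚ+ n 1 (Data.Nat.Coprimality.sym (Data.Nat.Coprimality.1-coprimeTo n))
  where import Data.Nat.Coprimality

-- es μ p = (e_0, …, e_p), by e_0 = 1 and
-- e_p = 1/(1-μ_p) Σ_{k=0}^{p-1} C(p,k) μ_k e_k.
es : (ℕ → ℚ) → (p : ℕ) → Vec ℚ (suc p)
es μ zero    = 1ℚ ∷ []
es μ (suc p) = Vec._∷ʳ_ prev new
  where
    prev : Vec ℚ (suc p)
    prev = es μ p
    new : ℚ
    new = inv (1ℚ - μ (suc p)) *
          Σ< (suc p) (λ k → ℕ→ℚ (suc p C toℕ k) * μ₀ μ (toℕ k) * lookup prev k)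

e : (ℕ → ℚ) → ℕ → ℚ
e μ p = Vec.last (es μ p)

allVecs : {A : Set} → List A → (n : ℕ) → List (Vec A n)
allVecs xs zero    = [] ∷ []
allVecs xs (suc n) = concatMap (λ x → map (x ∷_) (allVecs xs n)) xs

-- a permutation of {1,…,p} (p = suc n) in one-line notation:
-- π = (π(1), …, π(p)) with entries in Fin p, injective
IsPerm : {p : ℕ} → Vec (Fin p) p → Set
IsPerm {p} π = ∀ i j → lookup π i ≡ lookup π j → i ≡ j

isPerm? : {p : ℕ} → (π : Vec (Fin p) p) → Dec (IsPerm π)
isPerm? π = all? (λ i → all? (λ j → (lookup π i Fin.≟ lookup π j) →-dec (i Fin.≟ j)))

-- descent indicator vector: entry k (0-based, i.e. position k+1) is true
-- iff π(k+1) > π(k+2)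
descVec : {n : ℕ} → Vec (Fin (suc n)) (suc n) → Vec Bool n
descVec {n} π = tabulate (λ i → ⌊ lookup π (Fin.suc i) Fin.<? lookup π (inject₁ i) ⌋)

-- number of permutations of {1,…,n+1} whose descent set is
-- S = {k : j_k = true}
numDesc : {n : ℕ} → Vec Bool n → ℕ
numDesc {n} j =
  length (filter (λ π → isPerm? π ×-dec VecP.≡-dec BoolP._≟_ (descVec π) j)
                 (allVecs (List.allFin (suc n)) (suc n)))

monomial : {n : ℕ} → (ℕ → ℚ) → Vec Bool n → ℚ
monomial {n} μ j =
  Vec.foldr _ _*_ 1ℚ (tabulate (λ k → if lookup j k then μ (suc (toℕ k)) else 1ℚ))

sumBool : (n : ℕ) → (Vec Bool n → ℚ) → ℚ
sumBool n f = List.foldr _+_ 0ℚ (map f (allVecs (false ∷ true ∷ []) n))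

IsExpansion : (n : ℕ) → (Vec Bool n → ℚ) → Set
IsExpansion n a =
  (μ : ℕ → ℚ) → (∀ i → 1 ℕ.≤ i → ¬ (μ i ≡ 1ℚ)) →
  Π1 (suc n) (λ i → 1ℚ - μ i) * e μ (suc n) ≡ sumBool n (λ j → a j * monomial μ j)

-- Let β(S) count the permutations of {1, …, p} with descent set S, and α(U) = ∑_{S ⊆ U} β(S) those
-- with descent set inside U. Writing μ^S = ∏_{i ∈ S} μ_i ∏_{i ∉ S} (μ_i + (1 - μ_i)) and expanding gives
--   ∑_S β(S) μ^S = ∑_U α(U) ∏_{i ∈ U} μ_i ∏_{i ∉ U} (1 - μ_i).
-- Removing the smallest value of a permutation gives a recursion for α, from which α(U ∪ {k}) = C(p, k) α(U)
-- for U ⊆ {1, …, k - 1}: the positions after k carry an increasing run, fixed by the set of its values.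
-- Grouping the sets U by their largest element k therefore reproduces the recursion
--   (1 - μ₁) ⋯ (1 - μ_p) e_p = ∑_{k < p} C(p, k) μ_k (1 - μ₁) ⋯ (1 - μ_k) e_k ∏_{k < i < p} (1 - μ_i).
-- The coefficients are unique because a polynomial of degree at most one in μ₁ is determined by its
-- values at μ₁ = 0 and μ₁ = -1.

module Submission where

open import Defs
import Algebra
import Data.Rational.Properties
open import Data.Nat using (ℕ)
open import Data.Bool using (Bool)
open import Data.Rational using (ℚ)
open import Data.Vec using (Vec)
open import Data.Product using (_×_; _,_)
open import Relation.Binary.PropositionalEquality using (_≡_)

module ListSum {c ℓ} (R : Algebra.CommutativeSemiring c ℓ) where

  open import Data.List as List using (List; []; _∷_; _++_)
  open import Function using (_∘_)
  open Algebra.CommutativeSemiring R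
  open import Algebra.Properties.CommutativeSemigroup +-commutativeSemigroup using (interchange)

  private variable A B : Set

  ∑ : List A → (A → Carrier) → Carrier
  ∑ xs f = List.foldr _+_ 0# (List.map f xs)

  ∑-cong : (xs : List A) {f g : A → Carrier} → (∀ x → f x ≈ g x) → ∑ xs f ≈ ∑ xs g
  ∑-cong []       f≈g = refl
  ∑-cong (x ∷ xs) f≈g = +-cong (f≈g x) (∑-cong xs f≈g)

  ∑-++ : (xs ys : List A) (f : A → Carrier) → ∑ (xs ++ ys) f ≈ ∑ xs f + ∑ ys f
  ∑-++ []       ys f = sym (+-identityˡ _)
  ∑-++ (x ∷ xs) ys f = trans (+-congˡ (∑-++ xs ys f)) (sym (+-assoc _ _ _))

  ∑-map : (g : B → A) (xs : List B) (f : A → Carrier) → ∑ (List.map g xs) f ≈ ∑ xs (f ∘ g)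
  ∑-map g []       f = refl
  ∑-map g (x ∷ xs) f = +-congˡ (∑-map g xs f)

  ∑-concatMap : (g : B → List A) (xs : List B) (f : A → Carrier) →
                ∑ (List.concatMap g xs) f ≈ ∑ xs (λ x → ∑ (g x) f)
  ∑-concatMap g []       f = refl
  ∑-concatMap g (x ∷ xs) f = trans (∑-++ (g x) _ f) (+-congˡ (∑-concatMap g xs f))

  ∑-zero : (xs : List A) → ∑ xs (λ _ → 0#) ≈ 0#
  ∑-zero []       = refl
  ∑-zero (x ∷ xs) = trans (+-identityˡ _) (∑-zero xs)

  *-distribˡ-∑ : (xs : List A) (a : Carrier) (f : A → Carrier) → a * ∑ xs f ≈ ∑ xs (λ x → a * f x)
  *-distribˡ-∑ []       a f = zeroʳ a
  *-distribˡ-∑ (x ∷ xs) a f = trans (distribˡ a _ _) (+-congˡ (*-distribˡ-∑ xs a f))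

  ∑-distrib-+ : (xs : List A) (f g : A → Carrier) → ∑ xs (λ x → f x + g x) ≈ ∑ xs f + ∑ xs g
  ∑-distrib-+ []       f g = sym (+-identityˡ _)
  ∑-distrib-+ (x ∷ xs) f g = trans (+-congˡ (∑-distrib-+ xs f g)) (interchange _ _ _ _)

  ∑-comm : (xs : List A) (ys : List B) (f : A → B → Carrier) →
           ∑ xs (λ x → ∑ ys (f x)) ≈ ∑ ys (λ y → ∑ xs (λ x → f x y))
  ∑-comm []       ys f = sym (∑-zero ys)
  ∑-comm (x ∷ xs) ys f =
    trans (+-congˡ (∑-comm xs ys f)) (sym (∑-distrib-+ ys (f x) (λ y → ∑ xs (λ x′ → f x′ y))))

module ℚΣ = ListSum (Algebra.CommutativeRing.commutativeSemiring Data.Rational.Properties.+-*-commutativeRing)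

module Counting where

  open import Data.Nat as ℕ using (ℕ; suc; _+_; _*_)
  import Data.Nat.Properties as ℕP
  open import Data.Bool using (Bool; true; false; _∧_)
  open import Data.List as List using (List; []; _∷_; length; filter; map; concatMap)
  import Data.List.Properties as ListP
  open import Data.Fin as Fin using (Fin; zero; suc)
  import Data.Fin.Properties as FinP
  open import Data.Vec using ([]; _∷_)
  import Data.Vec.Properties as VecP
  open import Data.Product using (_×_; _,_; proj₁; proj₂)
  open import Data.Empty using (⊥-elim)
  open import Function using (_∘_; id)
  open import Level using (0ℓ)
  open import Relation.Unary using (Pred; Decidable)
  open import Relation.Nullary using (Dec; does; yes; no)
  open import Relation.Nullary.Decidable using (_×-dec_)
  open import Relation.Binary.Definitions using (DecidableEquality)
  open import Relation.Binary.PropositionalEquality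
  open ≡-Reasoning
  open import Defs using (allVecs)
  open ListSum ℕP.+-*-commutativeSemiring public

  𝟙 : Bool → ℕ
  𝟙 true  = 1
  𝟙 false = 0

  𝟙-∧ : ∀ a b → 𝟙 (a ∧ b) ≡ 𝟙 a * 𝟙 b
  𝟙-∧ true  b = sym (ℕP.+-identityʳ (𝟙 b))
  𝟙-∧ false b = refl

  does-⇔ : {A B : Set} → (A → B) → (B → A) → (a? : Dec A) (b? : Dec B) → does a? ≡ does b?
  does-⇔ to from (yes a) (yes b) = refl
  does-⇔ to from (yes a) (no ¬b) = ⊥-elim (¬b (to a))
  does-⇔ to from (no ¬a) (yes b) = ⊥-elim (¬a (from b))
  does-⇔ to from (no ¬a) (no ¬b) = refl

  length-filter : {A : Set} {P : Pred A 0ℓ} (P? : Decidable P) (xs : List A) →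
                  length (filter P? xs) ≡ ∑ xs (λ x → 𝟙 (does (P? x)))
  length-filter P? []       = refl
  length-filter P? (x ∷ xs) with does (P? x)
  ... | true  = cong suc (length-filter P? xs)
  ... | false = length-filter P? xs

  module _ {A : Set} (_≟_ : DecidableEquality A) where

    δ : A → A → ℕ
    δ a x = 𝟙 (does (a ≟ x))

    δ-refl : ∀ a → δ a a ≡ 1
    δ-refl a with a ≟ a
    ... | yes _  = refl
    ... | no a≢a = ⊥-elim (a≢a refl)

    δ-≢ : ∀ {a x} → a ≢ x → δ a x ≡ 0
    δ-≢ {a} {x} a≢x with a ≟ x
    ... | yes a≡x = ⊥-elim (a≢x a≡x)
    ... | no _    = refl

    Enumerates : List A → Set
    Enumerates xs = ∀ a → ∑ xs (δ a) ≡ 1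

    ∑-δ : (xs : List A) → Enumerates xs → ∀ a (f : A → ℕ) → ∑ xs (λ x → f x * δ a x) ≡ f a
    ∑-δ xs xs-enum a f = begin
      ∑ xs (λ x → f x * δ a x)  ≡⟨ ∑-cong xs f[x]δ≡f[a]δ ⟩
      ∑ xs (λ x → f a * δ a x)  ≡⟨ *-distribˡ-∑ xs (f a) (δ a) ⟨
      f a * ∑ xs (δ a)          ≡⟨ cong (f a *_) (xs-enum a) ⟩
      f a * 1                   ≡⟨ ℕP.*-identityʳ (f a) ⟩
      f a                       ∎
      where
      f[x]δ≡f[a]δ : ∀ x → f x * δ a x ≡ f a * δ a x
      f[x]δ≡f[a]δ x with a ≟ x
      ... | yes refl = refl
      ... | no _     = trans (ℕP.*-zeroʳ (f x)) (sym (ℕP.*-zeroʳ (f a)))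

  δ-injective : {A B : Set} (_≟A_ : DecidableEquality A) (_≟B_ : DecidableEquality B)
                (f : A → B) → (∀ {a a′} → f a ≡ f a′ → a ≡ a′) →
                ∀ a a′ → δ _≟B_ (f a) (f a′) ≡ δ _≟A_ a a′
  δ-injective _≟A_ _≟B_ f f-inj a a′ with a ≟A a′
  ... | yes refl = δ-refl _≟B_ (f a)
  ... | no a≢a′  = δ-≢ _≟B_ (a≢a′ ∘ f-inj)

  module _ {A B C : Set} (_≟A_ : DecidableEquality A) (_≟B_ : DecidableEquality B)
           (_≟C_ : DecidableEquality C) (h : A → B → C)
           (h-injective : ∀ {a a′ b b′} → h a b ≡ h a′ b′ → a ≡ a′ × b ≡ b′) where

    δ-pairing : ∀ a a′ b b′ → δ _≟C_ (h a b) (h a′ b′) ≡ δ _≟A_ a a′ * δ _≟B_ b b′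
    δ-pairing a a′ b b′ with a ≟A a′ | b ≟B b′
    ... | yes refl | yes refl = δ-refl _≟C_ (h a b)
    ... | yes refl | no b≢b′  = δ-≢ _≟C_ (b≢b′ ∘ proj₂ ∘ h-injective)
    ... | no a≢a′  | _        = δ-≢ _≟C_ (a≢a′ ∘ proj₁ ∘ h-injective)

    concatMap-enumerates : ∀ xs ys → Enumerates _≟A_ xs → Enumerates _≟B_ ys → ∀ a b →
                           ∑ (concatMap (λ a′ → map (h a′) ys) xs) (δ _≟C_ (h a b)) ≡ 1
    concatMap-enumerates xs ys xs-enum ys-enum a b = begin
      ∑ (concatMap (λ a′ → map (h a′) ys) xs) (δ _≟C_ (h a b))
        ≡⟨ ∑-concatMap _ xs _ ⟩
      ∑ xs (λ a′ → ∑ (map (h a′) ys) (δ _≟C_ (h a b)))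
        ≡⟨ ∑-cong xs (λ a′ → ∑-map (h a′) ys _) ⟩
      ∑ xs (λ a′ → ∑ ys (λ b′ → δ _≟C_ (h a b) (h a′ b′)))
        ≡⟨ ∑-cong xs (λ a′ → ∑-cong ys (δ-pairing a a′ b)) ⟩
      ∑ xs (λ a′ → ∑ ys (λ b′ → δ _≟A_ a a′ * δ _≟B_ b b′))
        ≡⟨ ∑-cong xs (λ a′ → sym (*-distribˡ-∑ ys (δ _≟A_ a a′) (δ _≟B_ b))) ⟩
      ∑ xs (λ a′ → δ _≟A_ a a′ * ∑ ys (δ _≟B_ b))
        ≡⟨ ∑-cong xs (λ a′ → trans (cong (δ _≟A_ a a′ *_) (ys-enum b)) (ℕP.*-identityʳ _)) ⟩
      ∑ xs (δ _≟A_ a)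
        ≡⟨ xs-enum a ⟩
      1 ∎

  allFin-enumerates : ∀ n → Enumerates Fin._≟_ (List.allFin n)
  allFin-enumerates (suc n) c = begin
    ∑ (List.allFin (suc n)) (δ Fin._≟_ c)
      ≡⟨ cong (λ xs → ∑ (zero ∷ xs) (δ Fin._≟_ c)) tabulate-suc ⟩
    δ Fin._≟_ c zero + ∑ (map suc (List.allFin n)) (δ Fin._≟_ c)
      ≡⟨ cong (δ Fin._≟_ c zero +_) (∑-map suc (List.allFin n) _) ⟩
    δ Fin._≟_ c zero + ∑ (List.allFin n) (δ Fin._≟_ c ∘ suc)
      ≡⟨ split c ⟩
    1 ∎
    where
    tabulate-suc : List.tabulate suc ≡ map suc (List.allFin n)
    tabulate-suc = sym (ListP.map-tabulate id suc)
    split : ∀ c → δ Fin._≟_ c zero + ∑ (List.allFin n) (δ Fin._≟_ c ∘ suc) ≡ 1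
    split zero    = cong suc (∑-zero (List.allFin n))
    split (suc c) = trans (∑-cong (List.allFin n) (δ-injective Fin._≟_ Fin._≟_ suc FinP.suc-injective c))
                          (allFin-enumerates n c)

  allVecs-enumerates : {A : Set} (_≟_ : DecidableEquality A) {xs : List A} → Enumerates _≟_ xs →
                       ∀ n → Enumerates (VecP.≡-dec _≟_) (allVecs xs n)
  allVecs-enumerates _≟_ xs-enum ℕ.zero  []       = refl
  allVecs-enumerates _≟_ {xs} xs-enum (suc n) (a ∷ as) =
    concatMap-enumerates _≟_ (VecP.≡-dec _≟_) (VecP.≡-dec _≟_) _∷_ VecP.∷-injective xs (allVecs xs n)
      xs-enum (allVecs-enumerates _≟_ xs-enum n) a as

  module _ {A B : Set} (_≟A_ : DecidableEquality A) (_≟B_ : DecidableEquality B)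
           {P : Pred A 0ℓ} {Q : Pred B 0ℓ} (P? : Decidable P) (Q? : Decidable Q)
           (f : A → B) (g : B → A) where

    count-bijection : ∀ xs ys → Enumerates _≟A_ xs → Enumerates _≟B_ ys →
                      (∀ {a} → P a → Q (f a) × g (f a) ≡ a) →
                      (∀ {b} → Q b → P (g b) × f (g b) ≡ b) →
                      ∑ xs (λ a → 𝟙 (does (P? a))) ≡ ∑ ys (λ b → 𝟙 (does (Q? b)))
    count-bijection xs ys xs-enum ys-enum f-sound g-sound = begin
      ∑ xs (λ a → 𝟙 (does (P? a)))
        ≡⟨ ∑-cong xs (λ a → ∑-δ _≟B_ ys ys-enum (f a) (λ _ → 𝟙 (does (P? a)))) ⟨
      ∑ xs (λ a → ∑ ys (λ b → 𝟙 (does (P? a)) * δ _≟B_ (f a) b))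
        ≡⟨ ∑-cong xs (λ a → ∑-cong ys (λ b → swap-roles a b)) ⟩
      ∑ xs (λ a → ∑ ys (λ b → 𝟙 (does (Q? b)) * δ _≟A_ (g b) a))
        ≡⟨ ∑-comm xs ys _ ⟩
      ∑ ys (λ b → ∑ xs (λ a → 𝟙 (does (Q? b)) * δ _≟A_ (g b) a))
        ≡⟨ ∑-cong ys (λ b → ∑-δ _≟A_ xs xs-enum (g b) (λ _ → 𝟙 (does (Q? b)))) ⟩
      ∑ ys (λ b → 𝟙 (does (Q? b))) ∎
      where
      swap-roles : ∀ a b → 𝟙 (does (P? a)) * δ _≟B_ (f a) b ≡ 𝟙 (does (Q? b)) * δ _≟A_ (g b) a
      swap-roles a b = begin
        𝟙 (does (P? a)) * δ _≟B_ (f a) b ≡⟨ 𝟙-∧ (does (P? a)) _ ⟨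
        𝟙 (does (P? a ×-dec f a ≟B b))   ≡⟨ cong 𝟙 (does-⇔ to from (P? a ×-dec f a ≟B b) (Q? b ×-dec g b ≟A a)) ⟩
        𝟙 (does (Q? b ×-dec g b ≟A a))   ≡⟨ 𝟙-∧ (does (Q? b)) _ ⟩
        𝟙 (does (Q? b)) * δ _≟A_ (g b) a ∎
        where
        to : P a × f a ≡ b → Q b × g b ≡ a
        to (Pa , refl) = f-sound Pa
        from : Q b × g b ≡ a → P a × f a ≡ b
        from (Qb , refl) = g-sound Qb

module Permutations where

  open import Data.Nat as ℕ using (ℕ; zero; suc)
  import Data.Nat.Properties as ℕP
  open import Data.Fin as Fin using (Fin; zero; suc; inject₁; punchIn; punchOut)
  import Data.Fin.Properties as FinP
  open import Data.Bool using (Bool; true; T; _≤_; b≤b)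
  open import Data.Bool.Properties using (_≤?_; ≤-minimum; ≤-maximum)
  open import Data.Vec as Vec using (Vec; []; _∷_; lookup; removeAt; insertAt; map)
  import Data.Vec.Properties as VecP
  open import Data.Product using (_×_; _,_; ∃)
  open import Data.Unit using (⊤; tt)
  open import Data.Empty using (⊥-elim)
  open import Function using (_∘_)
  open import Relation.Nullary using (Dec; yes; no)
  open import Relation.Nullary.Decidable using (⌊_⌋; isYes≗does; _×-dec_)
  open import Relation.Binary.PropositionalEquality

  private variable
    A : Set
    k m n p : ℕ

  Distinct : Vec A n → Set
  Distinct v = ∀ i j → lookup v i ≡ lookup v j → i ≡ j

  lookup-removeAt : (v : Vec A (suc n)) (i : Fin (suc n)) (j : Fin n) →
                    lookup (removeAt v i) j ≡ lookup v (punchIn i j)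
  lookup-removeAt v i j = begin
    lookup (removeAt v i) j                          ≡⟨ cong (lookup (removeAt v i)) (FinP.punchOut-punchIn i) ⟨
    lookup (removeAt v i) (punchOut i≢punchIn)       ≡⟨ VecP.removeAt-punchOut v i≢punchIn ⟩
    lookup v (punchIn i j)                           ∎
    where
    open ≡-Reasoning
    i≢punchIn : i ≢ punchIn i j
    i≢punchIn = FinP.punchInᵢ≢i i j ∘ sym

  lookup-insertAt : (v : Vec A n) (i : Fin (suc n)) (x : A) {j : Fin (suc n)} (i≢j : i ≢ j) →
                    lookup (insertAt v i x) j ≡ lookup v (punchOut i≢j)
  lookup-insertAt v i x i≢j =
    trans (cong (lookup (insertAt v i x)) (sym (FinP.punchIn-punchOut i≢j))) (VecP.insertAt-punchIn v i x _)

  Distinct-removeAt : (v : Vec A (suc n)) (i : Fin (suc n)) → Distinct v → Distinct (removeAt v i)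
  Distinct-removeAt v i v-distinct j j′ eq = FinP.punchIn-injective i j j′
    (v-distinct _ _ (trans (sym (lookup-removeAt v i j)) (trans eq (lookup-removeAt v i j′))))

  Distinct-insertAt : (v : Vec A n) (i : Fin (suc n)) (x : A) → Distinct v → (∀ j → lookup v j ≢ x) →
                      Distinct (insertAt v i x)
  Distinct-insertAt v i x v-distinct x∉v j j′ eq with i FinP.≟ j | i FinP.≟ j′
  ... | yes refl | yes refl = refl
  ... | yes refl | no i≢j′  = ⊥-elim (x∉v _ (trans (sym (lookup-insertAt v i x i≢j′))
                                         (trans (sym eq) (VecP.insertAt-lookup v i x))))
  ... | no i≢j   | yes refl = ⊥-elim (x∉v _ (trans (sym (lookup-insertAt v i x i≢j))
                                         (trans eq (VecP.insertAt-lookup v i x))))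
  ... | no i≢j   | no i≢j′  = FinP.punchOut-injective i≢j i≢j′
    (v-distinct _ _ (trans (sym (lookup-insertAt v i x i≢j)) (trans eq (lookup-insertAt v i x i≢j′))))

  Distinct-map : (f : A → Fin p) → (∀ {x y} → f x ≡ f y → x ≡ y) → (v : Vec A n) →
                 Distinct v → Distinct (map f v)
  Distinct-map f f-inj v v-distinct j j′ eq =
    v-distinct j j′ (f-inj (trans (sym (VecP.lookup-map j f v)) (trans eq (VecP.lookup-map j′ f v))))

  predᶠ : Fin (suc (suc m)) → Fin (suc m)
  predᶠ zero    = zero
  predᶠ (suc x) = x

  predᶠ-injective : {x y : Fin (suc (suc m))} → x ≢ zero → y ≢ zero → predᶠ x ≡ predᶠ y → x ≡ y
  predᶠ-injective {x = zero}            x≢0 _   _  = ⊥-elim (x≢0 refl)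
  predᶠ-injective {x = suc _} {zero}    _   y≢0 _  = ⊥-elim (y≢0 refl)
  predᶠ-injective {x = suc _} {suc _}   _   _   eq = cong suc eq

  ZeroFree : Vec (Fin (suc p)) n → Set
  ZeroFree v = ∀ j → lookup v j ≢ zero

  ZeroFree-map-suc : (w : Vec (Fin p) n) → ZeroFree (map suc w)
  ZeroFree-map-suc w j eq with () ← trans (sym (VecP.lookup-map j suc w)) eq

  ZeroFree-removeAt : (π : Vec (Fin (suc p)) (suc n)) (z : Fin (suc n)) → Distinct π →
                      lookup π z ≡ zero → ZeroFree (removeAt π z)
  ZeroFree-removeAt π z π-distinct πz≡0 j eq = FinP.punchInᵢ≢i z j
    (π-distinct _ _ (trans (sym (lookup-removeAt π z j)) (trans eq (sym πz≡0))))

  Distinct-map-predᶠ : (v : Vec (Fin (suc (suc m))) n) → Distinct v → ZeroFree v → Distinct (map predᶠ v)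
  Distinct-map-predᶠ v v-distinct v-zf j j′ eq = v-distinct j j′ (predᶠ-injective (v-zf j) (v-zf j′)
    (trans (sym (VecP.lookup-map j predᶠ v)) (trans eq (VecP.lookup-map j′ predᶠ v))))

  map-suc-predᶠ : (v : Vec (Fin (suc (suc m))) n) → ZeroFree v → map suc (map predᶠ v) ≡ v
  map-suc-predᶠ []          v-zf = refl
  map-suc-predᶠ (zero ∷ v)  v-zf = ⊥-elim (v-zf zero refl)
  map-suc-predᶠ (suc x ∷ v) v-zf = cong (suc x ∷_) (map-suc-predᶠ v (v-zf ∘ suc))

  map-predᶠ-suc : (w : Vec (Fin (suc m)) n) → map predᶠ (map suc w) ≡ w
  map-predᶠ-suc []      = refl
  map-predᶠ-suc (x ∷ w) = cong (x ∷_) (map-predᶠ-suc w)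

  -- pigeonhole: otherwise predᶠ ∘ lookup π would squeeze m + 1 distinct values into Fin m
  zero-exists : (π : Vec (Fin (suc m)) (suc m)) → Distinct π → ∃ λ j → lookup π j ≡ zero
  zero-exists {zero}  (zero ∷ []) _ = zero , refl
  zero-exists {suc m} π π-distinct with FinP.any? (λ j → lookup π j FinP.≟ zero)
  ... | yes found = found
  ... | no none
    with i , j , i<j , eq ← FinP.pigeonhole (ℕP.n<1+n (suc m)) (predᶠ ∘ lookup π) =
    ⊥-elim (ℕP.<-irrefl (cong Fin.toℕ i≡j) i<j)
    where
    i≡j : i ≡ j
    i≡j = π-distinct i j (predᶠ-injective (none ∘ (i ,_)) (none ∘ (j ,_)) eq)

  zeroIndex : Vec (Fin (suc m)) (suc m) → Fin (suc m)
  zeroIndex π with FinP.any? (λ j → lookup π j FinP.≟ zero)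
  ... | yes (j , _) = j
  ... | no _        = zero

  lookup-zeroIndex : (π : Vec (Fin (suc m)) (suc m)) → Distinct π → lookup π (zeroIndex π) ≡ zero
  lookup-zeroIndex π π-distinct with FinP.any? (λ j → lookup π j FinP.≟ zero)
  ... | yes (_ , πj≡0) = πj≡0
  ... | no none        = ⊥-elim (none (zero-exists π π-distinct))

  zeroIndex-unique : (π : Vec (Fin (suc m)) (suc m)) → Distinct π → ∀ {i} → lookup π i ≡ zero → zeroIndex π ≡ i
  zeroIndex-unique π π-distinct πi≡0 = π-distinct _ _ (trans (lookup-zeroIndex π π-distinct) (sym πi≡0))

  _<ᵇ_ : Fin p → Fin p → Bool
  x <ᵇ y = ⌊ x Fin.<? y ⌋

  <ᵇ-suc : (x y : Fin p) → suc x <ᵇ suc y ≡ x <ᵇ y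
  <ᵇ-suc x y = trans (isYes≗does (suc x Fin.<? suc y)) (sym (isYes≗does (x Fin.<? y)))

  -- as Defs.descVec, but for any range of values
  descents : Vec (Fin p) (suc k) → Vec Bool k
  descents π = Vec.tabulate (λ i → lookup π (suc i) <ᵇ lookup π (inject₁ i))

  -- descents of π only where V is true; the last entry of V is padding, so that removeAt V i always makes sense
  DescentsWithin : Vec Bool (suc k) → Vec (Fin p) (suc k) → Set
  DescentsWithin (_ ∷ [])     (_ ∷ [])     = ⊤
  DescentsWithin (b ∷ c ∷ bs) (x ∷ y ∷ ys) = y <ᵇ x ≤ b × DescentsWithin (c ∷ bs) (y ∷ ys)

  descentsWithin? : (V : Vec Bool (suc k)) (π : Vec (Fin p) (suc k)) → Dec (DescentsWithin V π)
  descentsWithin? (_ ∷ [])     (_ ∷ [])     = yes tt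
  descentsWithin? (b ∷ c ∷ bs) (x ∷ y ∷ ys) = (y <ᵇ x ≤? b) ×-dec descentsWithin? (c ∷ bs) (y ∷ ys)

  -- whether the smallest value may sit at position i
  allowed : Vec Bool (suc k) → Fin (suc k) → Bool
  allowed V zero    = true
  allowed V (suc i) = lookup V (inject₁ i)

  DescentsWithin-map-suc : (V : Vec Bool (suc k)) (v : Vec (Fin p) (suc k)) →
                           DescentsWithin V (map suc v) ≡ DescentsWithin V v
  DescentsWithin-map-suc (_ ∷ [])     (_ ∷ [])     = refl
  DescentsWithin-map-suc (b ∷ c ∷ bs) (x ∷ y ∷ ys) =
    cong₂ (λ y<x rest → y<x ≤ b × rest) (<ᵇ-suc y x) (DescentsWithin-map-suc (c ∷ bs) (y ∷ ys))

  private
    T⇒≤ : ∀ {b} a → T b → a ≤ b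
    T⇒≤ {true} a _ = ≤-maximum a

  DescentsWithin-removeAt : (V : Vec Bool (suc (suc k))) (π : Vec (Fin p) (suc (suc k))) (i : Fin (suc (suc k))) →
                            DescentsWithin V π → T (allowed V i) → DescentsWithin (removeAt V i) (removeAt π i)
  DescentsWithin-removeAt (b ∷ c ∷ bs)     (x ∷ y ∷ ys)     zero          (_ , ok) _  = ok
  DescentsWithin-removeAt (b ∷ c ∷ [])     (x ∷ y ∷ [])     (suc zero)    _        _  = tt
  DescentsWithin-removeAt (b ∷ c ∷ d ∷ ds) (x ∷ y ∷ z ∷ zs) (suc zero)    (_ , _ , ok) b-true =
    T⇒≤ (z <ᵇ x) b-true , ok
  DescentsWithin-removeAt (b ∷ c ∷ d ∷ ds) (x ∷ y ∷ z ∷ zs) (suc (suc i)) (y≤b , ok) allowed-i =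
    y≤b , DescentsWithin-removeAt (c ∷ d ∷ ds) (y ∷ z ∷ zs) (suc i) ok allowed-i

  DescentsWithin-insertAt : (V : Vec Bool (suc (suc k))) (w : Vec (Fin (suc p)) (suc k)) (i : Fin (suc (suc k))) →
                            DescentsWithin (removeAt V i) w → T (allowed V i) →
                            DescentsWithin V (insertAt w i zero)
  DescentsWithin-insertAt (b ∷ c ∷ bs)     (y ∷ ys)     zero          ok _ = ≤-minimum b , ok
  DescentsWithin-insertAt (b ∷ c ∷ [])     (x ∷ [])     (suc zero)    _  b-true = T⇒≤ (zero <ᵇ x) b-true , tt
  DescentsWithin-insertAt (b ∷ c ∷ d ∷ ds) (x ∷ y ∷ ys) (suc zero)    (_ , ok) b-true =
    T⇒≤ (zero <ᵇ x) b-true , ≤-minimum c , ok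
  DescentsWithin-insertAt (b ∷ c ∷ d ∷ ds) (x ∷ y ∷ ys) (suc (suc i)) (y≤b , ok) allowed-i =
    y≤b , DescentsWithin-insertAt (c ∷ d ∷ ds) (y ∷ ys) (suc i) ok allowed-i

  -- a minimum at position j + 1 is preceded by a descent at j
  allowed-minimum : (V : Vec Bool (suc k)) (π : Vec (Fin (suc p)) (suc k)) (j : Fin k) →
                    DescentsWithin V π → lookup π (suc j) ≡ zero → lookup π (inject₁ j) ≢ zero →
                    T (allowed V (suc j))
  allowed-minimum (b ∷ c ∷ bs) (zero  ∷ _ ∷ ys) zero    _          _    x≢0  = ⊥-elim (x≢0 refl)
  allowed-minimum (b ∷ c ∷ bs) (suc x ∷ _ ∷ ys) zero    (b≤b , _)  refl _    = tt
  allowed-minimum (b ∷ c ∷ bs) (x ∷ y ∷ ys)     (suc j) (_ , ok)   yj≡0 xj≢0 =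
    allowed-minimum (c ∷ bs) (y ∷ ys) j ok yj≡0 xj≢0

module MinimumRemoval where

  open import Data.Nat as ℕ using (ℕ; zero; suc; _*_)
  import Data.Nat.Properties as ℕP
  open import Data.Fin as Fin using (Fin; zero; suc; inject₁; toℕ)
  import Data.Fin.Properties as FinP
  open import Data.Bool using (Bool; T; _∧_)
  open import Data.List as List using (List; map; concatMap)
  open import Data.Vec as Vec using (Vec; lookup; removeAt; insertAt)
  import Data.Vec.Properties as VecP
  open import Data.Product using (_×_; _,_)
  import Data.Product.Properties as ProdP
  open import Data.Unit using (tt)
  open import Function using (id)
  open import Relation.Nullary using (Dec; does)
  open import Relation.Nullary.Decidable using (T?; _×-dec_)
  open import Relation.Binary.PropositionalEquality
  open ≡-Reasoning
  open import Defs using (allVecs; IsPerm; isPerm?)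
  open Counting
  open Permutations

  private variable m : ℕ

  vectors : ∀ p → List (Vec (Fin p) p)
  vectors p = allVecs (List.allFin p) p

  vectors-enumerate : ∀ p → Enumerates (VecP.≡-dec FinP._≟_) (vectors p)
  vectors-enumerate p = allVecs-enumerates FinP._≟_ (allFin-enumerates p) p

  Admissible : Vec Bool (suc m) → Vec (Fin (suc m)) (suc m) → Set
  Admissible V π = IsPerm π × DescentsWithin V π

  admissible? : (V : Vec Bool (suc m)) (π : Vec (Fin (suc m)) (suc m)) → Dec (Admissible V π)
  admissible? V π = isPerm? π ×-dec descentsWithin? V π

  -- Stanley's α: the number of permutations whose descent set is contained in the positions marked by V
  α : Vec Bool (suc m) → ℕ
  α V = ∑ (vectors _) (λ π → 𝟙 (does (admissible? V π)))

  allowed-zeroIndex : (V : Vec Bool (suc m)) (π : Vec (Fin (suc m)) (suc m)) →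
                      Admissible V π → T (allowed V (zeroIndex π))
  allowed-zeroIndex V π (π-perm , π-ok) with zeroIndex π | lookup-zeroIndex π π-perm
  ... | zero  | _    = tt
  ... | suc j | πj≡0 =
    allowed-minimum V π j π-ok πj≡0 (λ πj′≡0 → inject₁≢suc (π-perm _ _ (trans πj′≡0 (sym πj≡0))))
    where
    inject₁≢suc : inject₁ j ≢ suc j
    inject₁≢suc eq = ℕP.1+n≢n (trans (sym (cong toℕ eq)) (FinP.toℕ-inject₁ j))

  module Removal (V : Vec Bool (suc (suc m))) where

    Placement : Fin (suc (suc m)) × Vec (Fin (suc m)) (suc m) → Set
    Placement (i , w) = T (allowed V i) × Admissible (removeAt V i) w

    placement? : ∀ iw → Dec (Placement iw)
    placement? (i , w) = T? (allowed V i) ×-dec admissible? (removeAt V i) w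

    placements : List (Fin (suc (suc m)) × Vec (Fin (suc m)) (suc m))
    placements = concatMap (λ i → map (i ,_) (vectors (suc m))) (List.allFin (suc (suc m)))

    remove : Vec (Fin (suc (suc m))) (suc (suc m)) → Fin (suc (suc m)) × Vec (Fin (suc m)) (suc m)
    remove π = zeroIndex π , Vec.map predᶠ (removeAt π (zeroIndex π))

    insert : Fin (suc (suc m)) × Vec (Fin (suc m)) (suc m) → Vec (Fin (suc (suc m))) (suc (suc m))
    insert (i , w) = insertAt (Vec.map suc w) i zero

    placements-enumerate : Enumerates (ProdP.≡-dec FinP._≟_ (VecP.≡-dec FinP._≟_)) placements
    placements-enumerate (i , w) =
      concatMap-enumerates FinP._≟_ (VecP.≡-dec FinP._≟_) (ProdP.≡-dec FinP._≟_ (VecP.≡-dec FinP._≟_))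
        _,_ ProdP.,-injective (List.allFin _) (vectors _) (allFin-enumerates _) (vectors-enumerate _) i w

    remove-sound : ∀ {π} → Admissible V π → Placement (remove π) × insert (remove π) ≡ π
    remove-sound {π} adm@(π-perm , π-ok) = (allowed-z , w-perm , w-ok) , reinsert
      where
      z = zeroIndex π
      πz≡0 : lookup π z ≡ zero
      πz≡0 = lookup-zeroIndex π π-perm
      allowed-z : T (allowed V z)
      allowed-z = allowed-zeroIndex V π adm
      u = removeAt π z
      u-zf : ZeroFree u
      u-zf = ZeroFree-removeAt π z π-perm πz≡0
      suc-pred-u : Vec.map suc (Vec.map predᶠ u) ≡ u
      suc-pred-u = map-suc-predᶠ u u-zf
      w-perm : IsPerm (Vec.map predᶠ u)
      w-perm = Distinct-map-predᶠ u (Distinct-removeAt π z π-perm) u-zf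
      w-ok : DescentsWithin (removeAt V z) (Vec.map predᶠ u)
      w-ok = subst id (DescentsWithin-map-suc (removeAt V z) (Vec.map predᶠ u))
               (subst (DescentsWithin (removeAt V z)) (sym suc-pred-u) (DescentsWithin-removeAt V π z π-ok allowed-z))
      reinsert : insertAt (Vec.map suc (Vec.map predᶠ u)) z zero ≡ π
      reinsert = begin
        insertAt (Vec.map suc (Vec.map predᶠ u)) z zero  ≡⟨ cong (λ v → insertAt v z zero) suc-pred-u ⟩
        insertAt u z zero                              ≡⟨ cong (insertAt u z) πz≡0 ⟨
        insertAt u z (lookup π z)                      ≡⟨ VecP.insertAt-removeAt π z ⟩
        π                                              ∎

    insert-sound : ∀ {iw} → Placement iw → Admissible V (insert iw) × remove (insert iw) ≡ iw
    insert-sound {i , w} (allowed-i , w-perm , w-ok) = (π-perm , π-ok) , cong₂ _,_ z≡i w-back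
      where
      π = insertAt (Vec.map suc w) i zero
      π-perm : IsPerm π
      π-perm = Distinct-insertAt (Vec.map suc w) i zero (Distinct-map suc FinP.suc-injective w w-perm)
                 (ZeroFree-map-suc w)
      π-ok : DescentsWithin V π
      π-ok = DescentsWithin-insertAt V (Vec.map suc w) i
               (subst id (sym (DescentsWithin-map-suc (removeAt V i) w)) w-ok) allowed-i
      z≡i : zeroIndex π ≡ i
      z≡i = zeroIndex-unique π π-perm (VecP.insertAt-lookup (Vec.map suc w) i zero)
      w-back : Vec.map predᶠ (removeAt π (zeroIndex π)) ≡ w
      w-back = begin
        Vec.map predᶠ (removeAt π (zeroIndex π))  ≡⟨ cong (λ j → Vec.map predᶠ (removeAt π j)) z≡i ⟩
        Vec.map predᶠ (removeAt π i)              ≡⟨ cong (Vec.map predᶠ) (VecP.removeAt-insertAt (Vec.map suc w) i zero) ⟩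
        Vec.map predᶠ (Vec.map suc w)             ≡⟨ map-predᶠ-suc w ⟩
        w                                         ∎

  -- π ↦ (position of its smallest value, the other values renumbered) is a bijection
  α-removeMin : (V : Vec Bool (suc (suc m))) →
                α V ≡ ∑ (List.allFin (suc (suc m))) (λ i → 𝟙 (allowed V i) * α (removeAt V i))
  α-removeMin {m} V = begin
    α V
      ≡⟨ count-bijection (VecP.≡-dec FinP._≟_) (ProdP.≡-dec FinP._≟_ (VecP.≡-dec FinP._≟_))
           (admissible? V) placement? remove insert (vectors _) placements
           (vectors-enumerate _) placements-enumerate remove-sound insert-sound ⟩
    ∑ placements (λ iw → 𝟙 (does (placement? iw)))
      ≡⟨ ∑-concatMap (λ i → map (i ,_) perms) positions (λ iw → 𝟙 (does (placement? iw))) ⟩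
    ∑ positions (λ i → ∑ (map (i ,_) perms) (λ iw → 𝟙 (does (placement? iw))))
      ≡⟨ ∑-cong positions (λ i → ∑-map (i ,_) perms (λ iw → 𝟙 (does (placement? iw)))) ⟩
    ∑ positions (λ i → ∑ perms (λ w → 𝟙 (allowed V i ∧ admissible i w)))
      ≡⟨ ∑-cong positions (λ i → ∑-cong perms (λ w → 𝟙-∧ (allowed V i) (admissible i w))) ⟩
    ∑ positions (λ i → ∑ perms (λ w → 𝟙 (allowed V i) * 𝟙 (admissible i w)))
      ≡⟨ ∑-cong positions (λ i → *-distribˡ-∑ perms (𝟙 (allowed V i)) (λ w → 𝟙 (admissible i w))) ⟨
    ∑ positions (λ i → 𝟙 (allowed V i) * α (removeAt V i)) ∎
    where
    open Removal V
    positions : List (Fin (suc (suc m)))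
    positions = List.allFin (suc (suc m))
    perms : List (Vec (Fin (suc m)) (suc m))
    perms = vectors (suc m)
    admissible : Fin (suc (suc m)) → Vec (Fin (suc m)) (suc m) → Bool
    admissible i w = does (admissible? (removeAt V i) w)

module IncreasingRuns where

  open import Data.Nat as ℕ using (ℕ; zero; suc; _+_; _*_; _<_; z≤n; s≤s)
  import Data.Nat.Properties as ℕP
  open import Data.Nat.Combinatorics using (_C_; nCk+nC[k+1]≡[n+1]C[k+1]; nCn≡1)
  open import Data.Bool using (Bool; true; false; T)
  open import Data.Bool.Properties using (T-≡)
  open import Function.Bundles using (Equivalence)
  open import Data.Unit using (tt)
  open import Data.List as List using (List; []; _∷_; _++_; length; replicate)
  import Data.List.Properties as ListP
  open import Data.Fin as Fin using (Fin; toℕ; inject₁)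
  import Data.Fin.Properties as FinP
  open import Data.Vec as Vec using (Vec; lookup; removeAt; toList; fromList)
  import Data.Vec.Properties as VecP
  open import Function using (_∘_)
  open import Relation.Binary.PropositionalEquality
  open ≡-Reasoning
  open Counting using (𝟙; ∑; ∑-map; ∑-cong)
  open Permutations using (allowed)
  open MinimumRemoval using (α; α-removeMin)

  private variable m : ℕ

  sumBelow : ℕ → (ℕ → ℕ) → ℕ
  sumBelow zero    f = 0
  sumBelow (suc n) f = f 0 + sumBelow n (f ∘ suc)

  sumBelow-+ : ∀ m n f → sumBelow (m + n) f ≡ sumBelow m f + sumBelow n (λ i → f (m + i))
  sumBelow-+ zero    n f = refl
  sumBelow-+ (suc m) n f = trans (cong (f 0 +_) (sumBelow-+ m n (f ∘ suc))) (sym (ℕP.+-assoc (f 0) _ _))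

  sumBelow-cong : ∀ n {f g : ℕ → ℕ} → (∀ i → i < n → f i ≡ g i) → sumBelow n f ≡ sumBelow n g
  sumBelow-cong zero    f≡g = refl
  sumBelow-cong (suc n) f≡g = cong₂ _+_ (f≡g 0 (s≤s z≤n)) (sumBelow-cong n (λ i i<n → f≡g (suc i) (s≤s i<n)))

  sumBelow-zero : ∀ n → sumBelow n (λ _ → 0) ≡ 0
  sumBelow-zero zero    = refl
  sumBelow-zero (suc n) = sumBelow-zero n

  *-distribˡ-sumBelow : ∀ n c f → c * sumBelow n f ≡ sumBelow n (λ i → c * f i)
  *-distribˡ-sumBelow zero    c f = ℕP.*-zeroʳ c
  *-distribˡ-sumBelow (suc n) c f =
    trans (ℕP.*-distribˡ-+ c (f 0) _) (cong (c * f 0 +_) (*-distribˡ-sumBelow n c (f ∘ suc)))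

  ∑-allFin : ∀ n (f : ℕ → ℕ) → ∑ (List.allFin n) (f ∘ toℕ) ≡ sumBelow n f
  ∑-allFin zero    f = refl
  ∑-allFin (suc n) f = cong (f 0 +_) (begin
    ∑ (List.tabulate {n = n} Fin.suc) (f ∘ toℕ)
      ≡⟨ cong (λ xs → ∑ xs (f ∘ toℕ)) (ListP.map-tabulate {n = n} (λ i → i) Fin.suc) ⟨
    ∑ (List.map Fin.suc (List.allFin n)) (f ∘ toℕ)
      ≡⟨ ∑-map Fin.suc (List.allFin n) (f ∘ toℕ) ⟩
    ∑ (List.allFin n) (f ∘ suc ∘ toℕ)
      ≡⟨ ∑-allFin n (f ∘ suc) ⟩
    sumBelow n (f ∘ suc) ∎)

  lookupᴸ : List Bool → ℕ → Bool
  lookupᴸ []       _       = false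
  lookupᴸ (b ∷ bs) zero    = b
  lookupᴸ (b ∷ bs) (suc i) = lookupᴸ bs i

  allowedᴸ : List Bool → ℕ → Bool
  allowedᴸ bs zero    = true
  allowedᴸ bs (suc i) = lookupᴸ bs i

  removeᴸ : List Bool → ℕ → List Bool
  removeᴸ []       _       = []
  removeᴸ (b ∷ bs) zero    = bs
  removeᴸ (b ∷ bs) (suc i) = b ∷ removeᴸ bs i

  lookup-fromList : (bs : List Bool) (i : Fin (length bs)) → lookup (fromList bs) i ≡ lookupᴸ bs (toℕ i)
  lookup-fromList (b ∷ bs) Fin.zero    = refl
  lookup-fromList (b ∷ bs) (Fin.suc i) = lookup-fromList bs i

  allowed-fromList : (b : Bool) (bs : List Bool) (i : Fin (suc (length bs))) →
                     allowed (fromList (b ∷ bs)) i ≡ allowedᴸ (b ∷ bs) (toℕ i)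
  allowed-fromList b bs Fin.zero    = refl
  allowed-fromList b bs (Fin.suc i) =
    trans (lookup-fromList (b ∷ bs) (inject₁ i)) (cong (lookupᴸ (b ∷ bs)) (FinP.toℕ-inject₁ i))

  toList-removeAt-fromList : (b : Bool) (bs : List Bool) (i : Fin (suc (length bs))) →
                             toList (removeAt (fromList (b ∷ bs)) i) ≡ removeᴸ (b ∷ bs) (toℕ i)
  toList-removeAt-fromList b bs       Fin.zero    = VecP.toList∘fromList bs
  toList-removeAt-fromList b (c ∷ cs) (Fin.suc i) = cong (b ∷_) (toList-removeAt-fromList c cs i)

  α-cong-toList : ∀ {n} (V : Vec Bool (suc m)) (U : Vec Bool (suc n)) → toList V ≡ toList U → α V ≡ α U
  α-cong-toList V U V≡U with ℕP.suc-injective (trans (sym (VecP.length-toList V))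
                                               (trans (cong length V≡U) (VecP.length-toList U)))
  ... | refl = cong α (trans (sym (VecP.cast-is-id refl V)) (VecP.toList-injective refl V U V≡U))

  -- α on lists: the empty list stands for the single empty permutation
  αᴸ : List Bool → ℕ
  αᴸ []       = 1
  αᴸ (b ∷ bs) = α (fromList (b ∷ bs))

  αᴸ-toList : (V : Vec Bool (suc m)) → αᴸ (toList V) ≡ α V
  αᴸ-toList V@(b Vec.∷ bs) = α-cong-toList (fromList (b ∷ toList bs)) V (VecP.toList∘fromList (toList V))

  αᴸ-removeMin : ∀ b bs → αᴸ (b ∷ bs) ≡
                 sumBelow (suc (length bs)) (λ i → 𝟙 (allowedᴸ (b ∷ bs) i) * αᴸ (removeᴸ (b ∷ bs) i))
  αᴸ-removeMin b []       = refl
  αᴸ-removeMin b (c ∷ cs) = begin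
    α V                                            ≡⟨ α-removeMin V ⟩
    ∑ (List.allFin n) (λ i → 𝟙 (allowed V i) * α (removeAt V i))  ≡⟨ ∑-cong (List.allFin n) to-lists ⟩
    ∑ (List.allFin n) (f ∘ toℕ)                      ≡⟨ ∑-allFin n f ⟩
    sumBelow n f                                     ∎
    where
    n = length (b ∷ c ∷ cs)
    V = fromList (b ∷ c ∷ cs)
    f : ℕ → ℕ
    f i = 𝟙 (allowedᴸ (b ∷ c ∷ cs) i) * αᴸ (removeᴸ (b ∷ c ∷ cs) i)
    to-lists : ∀ i → 𝟙 (allowed V i) * α (removeAt V i) ≡ f (toℕ i)
    to-lists i = cong₂ (λ a r → 𝟙 a * r) (allowed-fromList b (c ∷ cs) i)
      (trans (sym (αᴸ-toList (removeAt V i))) (cong αᴸ (toList-removeAt-fromList b (c ∷ cs) i)))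

  αᴸ-removeMin′ : ∀ W → 0 < length W → αᴸ W ≡ sumBelow (length W) (λ i → 𝟙 (allowedᴸ W i) * αᴸ (removeᴸ W i))
  αᴸ-removeMin′ (b ∷ bs) _ = αᴸ-removeMin b bs

  lookupᴸ-++ˡ : ∀ W G {i} → i < length W → lookupᴸ (W ++ G) i ≡ lookupᴸ W i
  lookupᴸ-++ˡ (b ∷ W) G {zero}  _         = refl
  lookupᴸ-++ˡ (b ∷ W) G {suc i} (s≤s i<n) = lookupᴸ-++ˡ W G i<n

  lookupᴸ-++ʳ : ∀ W G j → lookupᴸ (W ++ G) (length W + j) ≡ lookupᴸ G j
  lookupᴸ-++ʳ []      G j = refl
  lookupᴸ-++ʳ (b ∷ W) G j = lookupᴸ-++ʳ W G j

  allowedᴸ-++ˡ : ∀ W G {i} → i ℕ.≤ length W → allowedᴸ (W ++ G) i ≡ allowedᴸ W i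
  allowedᴸ-++ˡ W G {zero}  _   = refl
  allowedᴸ-++ˡ W G {suc i} i<n = lookupᴸ-++ˡ W G i<n

  removeᴸ-++ˡ : ∀ W G {i} → i < length W → removeᴸ (W ++ G) i ≡ removeᴸ W i ++ G
  removeᴸ-++ˡ (b ∷ W) G {zero}  _         = refl
  removeᴸ-++ˡ (b ∷ W) G {suc i} (s≤s i<n) = cong (b ∷_) (removeᴸ-++ˡ W G i<n)

  removeᴸ-++-length : ∀ W b G → removeᴸ (W ++ b ∷ G) (length W) ≡ W ++ G
  removeᴸ-++-length []      b G = refl
  removeᴸ-++-length (c ∷ W) b G = cong (c ∷_) (removeᴸ-++-length W b G)

  length-removeᴸ : ∀ W {i} → i < length W → suc (length (removeᴸ W i)) ≡ length W
  length-removeᴸ (b ∷ W) {zero}  _         = refl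
  length-removeᴸ (b ∷ W) {suc i} (s≤s i<n) = cong suc (length-removeᴸ W i<n)

  allowedᴸ-end-removeᴸ : ∀ W {i} → i < length W → T (allowedᴸ W i) → T (allowedᴸ W (length W)) →
                         T (allowedᴸ (removeᴸ W i) (length (removeᴸ W i)))
  allowedᴸ-end-removeᴸ (b ∷ [])         {zero}        _         _  _   = tt
  allowedᴸ-end-removeᴸ (b ∷ c ∷ cs)     {zero}        _         _  end = end
  allowedᴸ-end-removeᴸ (b ∷ [])         {suc _}       (s≤s ())
  allowedᴸ-end-removeᴸ (b ∷ c ∷ [])     {suc zero}    _         ok _   = ok
  allowedᴸ-end-removeᴸ (b ∷ c ∷ d ∷ ds) {suc zero}    _         _  end = end
  allowedᴸ-end-removeᴸ (b ∷ c ∷ cs)     {suc (suc i)} (s≤s i<n) ok end = allowedᴸ-end-removeᴸ (c ∷ cs) i<n ok end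

  run : ℕ → List Bool
  run r = replicate r false ++ true ∷ []

  length-run : ∀ r → length (run r) ≡ suc r
  length-run zero    = refl
  length-run (suc r) = cong suc (length-run r)

  lookupᴸ-run : ∀ {r j} → j < r → lookupᴸ (run r) j ≡ false
  lookupᴸ-run {suc r} {zero}  _         = refl
  lookupᴸ-run {suc r} {suc j} (s≤s j<r) = lookupᴸ-run j<r

  -- split by the position of the minimum: inside W, first entry of the run, or later in the run (never allowed)
  αᴸ-++-run-split : ∀ W r → T (allowedᴸ W (length W)) →
                    αᴸ (W ++ run r) ≡ sumBelow (length W) (λ i → 𝟙 (allowedᴸ W i) * αᴸ (removeᴸ W i ++ run r))
                                      + αᴸ (removeᴸ (W ++ run r) (length W))
  αᴸ-++-run-split W r end = begin
    αᴸ L                                                           ≡⟨ αᴸ-removeMin′ L 0<|L| ⟩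
    sumBelow (length L) h                                          ≡⟨ cong (λ n → sumBelow n h) |L|≡k+1+r ⟩
    sumBelow (k + suc r) h                                         ≡⟨ sumBelow-+ k (suc r) h ⟩
    sumBelow k h + (h (k + 0) + sumBelow r (λ j → h (k + suc j)))
      ≡⟨ cong₂ (λ a b → a + (h (k + 0) + b)) inside after-start ⟩
    sumBelow k h′ + (h (k + 0) + 0)                                ≡⟨ cong (sumBelow k h′ +_) start ⟩
    sumBelow k h′ + αᴸ (removeᴸ L k)                               ∎
    where
    k = length W
    L = W ++ run r
    h h′ : ℕ → ℕ
    h  i = 𝟙 (allowedᴸ L i) * αᴸ (removeᴸ L i)
    h′ i = 𝟙 (allowedᴸ W i) * αᴸ (removeᴸ W i ++ run r)
    |L|≡k+1+r : length L ≡ k + suc r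
    |L|≡k+1+r = trans (ListP.length-++ W) (cong (k +_) (length-run r))
    0<|L| : 0 < length L
    0<|L| = subst (0 <_) (sym (trans |L|≡k+1+r (ℕP.+-suc k r))) (s≤s z≤n)
    inside : sumBelow k h ≡ sumBelow k h′
    inside = sumBelow-cong k (λ i i<k → cong₂ (λ a R → 𝟙 a * αᴸ R)
               (allowedᴸ-++ˡ W (run r) (ℕP.<⇒≤ i<k)) (removeᴸ-++ˡ W (run r) i<k))
    after-start : sumBelow r (λ j → h (k + suc j)) ≡ 0
    after-start = trans (sumBelow-cong r (λ j j<r → cong (λ a → 𝟙 a * αᴸ (removeᴸ L (k + suc j)))
                    (trans (cong (allowedᴸ L) (ℕP.+-suc k j)) (trans (lookupᴸ-++ʳ W (run r) j) (lookupᴸ-run j<r)))))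
                  (sumBelow-zero r)
    start : h (k + 0) + 0 ≡ αᴸ (removeᴸ L k)
    start = begin
      h (k + 0) + 0                      ≡⟨ trans (ℕP.+-identityʳ _) (cong h (ℕP.+-identityʳ k)) ⟩
      𝟙 (allowedᴸ L k) * αᴸ (removeᴸ L k) ≡⟨ cong (λ a → 𝟙 a * αᴸ (removeᴸ L k)) (allowedᴸ-++ˡ W (run r) ℕP.≤-refl) ⟩
      𝟙 (allowedᴸ W k) * αᴸ (removeᴸ L k) ≡⟨ cong (λ a → 𝟙 a * αᴸ (removeᴸ L k)) (Equivalence.to T-≡ end) ⟩
      1 * αᴸ (removeᴸ L k)               ≡⟨ ℕP.*-identityˡ _ ⟩
      αᴸ (removeᴸ L k)                   ∎

  -- αᴸ-++-run at size length W + r = n, the induction measure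
  RunFormula : ℕ → Set
  RunFormula n = ∀ W r → length W + r ≡ n → T (allowedᴸ W (length W)) →
                 αᴸ (W ++ run r) ≡ (suc (length W + r) C length W) * αᴸ W

  private
    run-start : ∀ {n} → RunFormula n → ∀ W r → length W + r ≡ suc n → T (allowedᴸ W (length W)) →
                αᴸ (removeᴸ (W ++ run r) (length W)) ≡ ((length W + r) C length W) * αᴸ W
    run-start IH W zero _ _ = begin
      αᴸ (removeᴸ (W ++ true ∷ []) k) ≡⟨ cong αᴸ (trans (removeᴸ-++-length W true []) (ListP.++-identityʳ W)) ⟩
      αᴸ W                            ≡⟨ ℕP.*-identityˡ (αᴸ W) ⟨
      1 * αᴸ W                        ≡⟨ cong (_* αᴸ W) (trans (sym (nCn≡1 k)) (cong (_C k) (sym (ℕP.+-identityʳ k)))) ⟩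
      ((k + 0) C k) * αᴸ W              ∎
      where k = length W
    run-start IH W (suc r) size end = begin
      αᴸ (removeᴸ (W ++ false ∷ run r) k) ≡⟨ cong αᴸ (removeᴸ-++-length W false (run r)) ⟩
      αᴸ (W ++ run r)                     ≡⟨ IH W r (ℕP.suc-injective (trans (sym (ℕP.+-suc k r)) size)) end ⟩
      (suc (k + r) C k) * αᴸ W            ≡⟨ cong (λ m → (m C k) * αᴸ W) (ℕP.+-suc k r) ⟨
      ((k + suc r) C k) * αᴸ W              ∎
      where k = length W

    run-inside : ∀ {n} → RunFormula n → ∀ b bs r → length bs + r ≡ n → T (allowedᴸ (b ∷ bs) (length (b ∷ bs))) →
                 sumBelow (suc (length bs)) (λ i → 𝟙 (allowedᴸ (b ∷ bs) i) * αᴸ (removeᴸ (b ∷ bs) i ++ run r))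
                 ≡ (suc (length bs + r) C length bs) * αᴸ (b ∷ bs)
    run-inside IH b bs r size end = begin
      sumBelow (suc k) (λ i → 𝟙 (allowedᴸ W i) * αᴸ (removeᴸ W i ++ run r))
        ≡⟨ sumBelow-cong (suc k) shrink ⟩
      sumBelow (suc k) (λ i → c * (𝟙 (allowedᴸ W i) * αᴸ (removeᴸ W i)))
        ≡⟨ *-distribˡ-sumBelow (suc k) c (λ i → 𝟙 (allowedᴸ W i) * αᴸ (removeᴸ W i)) ⟨
      c * sumBelow (suc k) (λ i → 𝟙 (allowedᴸ W i) * αᴸ (removeᴸ W i))
        ≡⟨ cong (c *_) (αᴸ-removeMin b bs) ⟨
      c * αᴸ W ∎
      where
      W = b ∷ bs
      k = length bs
      c = suc (k + r) C k
      shrink : ∀ i → i < suc k →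
               𝟙 (allowedᴸ W i) * αᴸ (removeᴸ W i ++ run r) ≡ c * (𝟙 (allowedᴸ W i) * αᴸ (removeᴸ W i))
      shrink i i<|W| with allowedᴸ W i in allowed-i
      ... | false = sym (ℕP.*-zeroʳ c)
      ... | true  = begin
        1 * αᴸ (R ++ run r)                     ≡⟨ ℕP.*-identityˡ _ ⟩
        αᴸ (R ++ run r)                         ≡⟨ IH R r (trans (cong (_+ r) |R|≡k) size)
                                                     (allowedᴸ-end-removeᴸ W i<|W| (Equivalence.from T-≡ allowed-i) end) ⟩
        (suc (length R + r) C length R) * αᴸ R  ≡⟨ cong (λ m → (suc (m + r) C m) * αᴸ R) |R|≡k ⟩
        c * αᴸ R                                ≡⟨ cong (c *_) (ℕP.*-identityˡ _) ⟨
        c * (1 * αᴸ R)                          ∎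
        where
        R = removeᴸ W i
        |R|≡k : length R ≡ k
        |R|≡k = ℕP.suc-injective (length-removeᴸ W i<|W|)

    run-formula : ∀ n → RunFormula n
    run-formula zero    []       zero    _    _   = refl
    run-formula (suc n) []       r       size end =
      trans (αᴸ-++-run-split [] r end) (run-start (run-formula n) [] r size end)
    run-formula (suc n) (b ∷ bs) r       size end = begin
      αᴸ (b ∷ bs ++ run r)
        ≡⟨ αᴸ-++-run-split (b ∷ bs) r end ⟩
      sumBelow (suc k) (λ i → 𝟙 (allowedᴸ (b ∷ bs) i) * αᴸ (removeᴸ (b ∷ bs) i ++ run r))
      + αᴸ (removeᴸ (b ∷ bs ++ run r) (suc k))
        ≡⟨ cong₂ _+_ (run-inside (run-formula n) b bs r (ℕP.suc-injective size) end)
                     (run-start (run-formula n) (b ∷ bs) r size end) ⟩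
      (suc (k + r) C k) * αᴸ (b ∷ bs) + ((suc k + r) C suc k) * αᴸ (b ∷ bs)
        ≡⟨ ℕP.*-distribʳ-+ (αᴸ (b ∷ bs)) (suc (k + r) C k) _ ⟨
      (suc (k + r) C k + suc (k + r) C suc k) * αᴸ (b ∷ bs)
        ≡⟨ cong (_* αᴸ (b ∷ bs)) (nCk+nC[k+1]≡[n+1]C[k+1] (suc (k + r)) k) ⟩
      (suc (suc k + r) C suc k) * αᴸ (b ∷ bs) ∎
      where k = length bs

  -- an increasing run of length r + 1 after W: choose which values go into the run
  αᴸ-++-run : ∀ W r → T (allowedᴸ W (length W)) → αᴸ (W ++ run r) ≡ (suc (length W + r) C length W) * αᴸ W
  αᴸ-++-run W r = run-formula (length W + r) W r refl

module DescentSets where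

  open import Data.Nat as ℕ using (ℕ; suc; _*_)
  import Data.Nat.Properties as ℕP
  open import Data.Fin as Fin using (Fin)
  open import Data.Bool using (Bool; true; false; _≤_; _∧_)
  import Data.Bool.Properties as BoolP
  open import Data.List as List using (List; []; _∷_)
  open import Data.Vec as Vec using (Vec; []; _∷_; _∷ʳ_)
  import Data.Vec.Properties as VecP
  open import Data.Vec.Relation.Binary.Pointwise.Inductive as Pointwise using (Pointwise; []; _∷_)
  open import Data.Product using (_,_)
  open import Data.Unit using (tt)
  open import Relation.Nullary using (Dec; does)
  open import Relation.Binary.Definitions using (DecidableEquality)
  open import Relation.Binary.PropositionalEquality
  open ≡-Reasoning
  open import Defs using (allVecs; numDesc; descVec; isPerm?)
  open Counting
  open Permutations using (descents; DescentsWithin; descentsWithin?)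
  open MinimumRemoval using (vectors; vectors-enumerate; α)
  open import Algebra.Properties.CommutativeSemigroup ℕP.*-commutativeSemigroup using (x∙yz≈yx∙z)

  private variable k n p : ℕ

  _⊆_ : Vec Bool n → Vec Bool n → Set
  S ⊆ U = Pointwise _≤_ S U

  _⊆?_ : (S U : Vec Bool n) → Dec (S ⊆ U)
  _⊆?_ = Pointwise.decidable BoolP._≤?_

  𝟙[_⊆_] : Vec Bool n → Vec Bool n → ℕ
  𝟙[ S ⊆ U ] = 𝟙 (does (S ⊆? U))

  bools : ∀ n → List (Vec Bool n)
  bools = allVecs (false ∷ true ∷ [])

  bools-enumerate : ∀ n → Enumerates (VecP.≡-dec BoolP._≟_) (bools n)
  bools-enumerate = allVecs-enumerates BoolP._≟_ λ { false → refl ; true → refl }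

  descents-⊆⇒ : (π : Vec (Fin p) (suc k)) (U : Vec Bool k) → descents π ⊆ U → DescentsWithin (U ∷ʳ true) π
  descents-⊆⇒ (x ∷ [])         []            []           = tt
  descents-⊆⇒ (x ∷ y ∷ [])     (u ∷ [])      (y<x≤u ∷ []) = y<x≤u , tt
  descents-⊆⇒ (x ∷ y ∷ z ∷ zs) (u ∷ u′ ∷ us) (y<x≤u ∷ ⊆)  = y<x≤u , descents-⊆⇒ (y ∷ z ∷ zs) (u′ ∷ us) ⊆

  descents-⊆⇐ : (π : Vec (Fin p) (suc k)) (U : Vec Bool k) → DescentsWithin (U ∷ʳ true) π → descents π ⊆ U
  descents-⊆⇐ (x ∷ [])         []            _            = []
  descents-⊆⇐ (x ∷ y ∷ [])     (u ∷ [])      (y<x≤u , _)  = y<x≤u ∷ []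
  descents-⊆⇐ (x ∷ y ∷ z ∷ zs) (u ∷ u′ ∷ us) (y<x≤u , ok) = y<x≤u ∷ descents-⊆⇐ (y ∷ z ∷ zs) (u′ ∷ us) ok

  numDesc-∑ : (S : Vec Bool n) →
              numDesc S ≡ ∑ (vectors (suc n)) (λ π → 𝟙 (does (isPerm? π)) * δ (VecP.≡-dec BoolP._≟_) (descVec π) S)
  numDesc-∑ {n} S = trans (length-filter _ (vectors (suc n)))
    (∑-cong (vectors (suc n)) (λ π → 𝟙-∧ (does (isPerm? π)) (does (VecP.≡-dec BoolP._≟_ (descVec π) S))))

  ∑-⊆-numDesc : (U : Vec Bool n) → ∑ (bools n) (λ S → 𝟙[ S ⊆ U ] * numDesc S) ≡ α (U ∷ʳ true)
  ∑-⊆-numDesc {n} U = begin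
    ∑ (bools n) (λ S → 𝟙[ S ⊆ U ] * numDesc S)
      ≡⟨ ∑-cong (bools n) (λ S → trans (cong (𝟙[ S ⊆ U ] *_) (numDesc-∑ S))
                                      (*-distribˡ-∑ perms 𝟙[ S ⊆ U ] (λ π → perm π * δ _≟_ (descVec π) S))) ⟩
    ∑ (bools n) (λ S → ∑ perms (λ π → 𝟙[ S ⊆ U ] * (perm π * δ _≟_ (descVec π) S)))
      ≡⟨ ∑-comm (bools n) perms (λ S π → 𝟙[ S ⊆ U ] * (perm π * δ _≟_ (descVec π) S)) ⟩
    ∑ perms (λ π → ∑ (bools n) (λ S → 𝟙[ S ⊆ U ] * (perm π * δ _≟_ (descVec π) S)))
      ≡⟨ ∑-cong perms (λ π → ∑-cong (bools n) (λ S → x∙yz≈yx∙z 𝟙[ S ⊆ U ] (perm π) (δ _≟_ (descVec π) S))) ⟩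
    ∑ perms (λ π → ∑ (bools n) (λ S → perm π * 𝟙[ S ⊆ U ] * δ _≟_ (descVec π) S))
      ≡⟨ ∑-cong perms (λ π → ∑-δ _≟_ (bools n) (bools-enumerate n) (descVec π) (λ S → perm π * 𝟙[ S ⊆ U ])) ⟩
    ∑ perms (λ π → perm π * 𝟙[ descVec π ⊆ U ])
      ≡⟨ ∑-cong perms (λ π → trans (sym (𝟙-∧ (does (isPerm? π)) _)) (cong (λ b → 𝟙 (does (isPerm? π) ∧ b))
           (does-⇔ (descents-⊆⇒ π U) (descents-⊆⇐ π U) (descVec π ⊆? U) (descentsWithin? (U ∷ʳ true) π)))) ⟩
    α (U ∷ʳ true) ∎
    where
    _≟_ : DecidableEquality (Vec Bool n)
    _≟_ = VecP.≡-dec BoolP._≟_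
    perms : List (Vec (Fin (suc n)) (suc n))
    perms = vectors (suc n)
    perm : Vec (Fin (suc n)) (suc n) → ℕ
    perm π = 𝟙 (does (isPerm? π))

module NatCast where

  open import Data.Nat as ℕ using (ℕ; zero; suc)
  open import Data.Rational using (1ℚ; _+_; _*_)
  import Data.Rational.Properties as ℚP
  import Data.Rational.Unnormalised as ℚᵘ
  import Data.Rational.Unnormalised.Properties as ℚᵘP
  import Data.Integer as ℤ
  import Data.Integer.Properties as ℤP
  open import Data.List using (List; []; _∷_)
  open import Function using (_∘_)
  open import Relation.Binary.PropositionalEquality
  open import Defs using (ℕ→ℚ)
  import Algebra.Properties.Semiring.Mult (Algebra.CommutativeRing.semiring ℚP.+-*-commutativeRing) as Mult
  module ℕΣ = Counting

  ℕ→ℚ-suc : ∀ n → ℕ→ℚ (suc n) ≡ 1ℚ + ℕ→ℚ n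
  ℕ→ℚ-suc n = ℚP.toℚᵘ-injective (ℚᵘP.≃-trans (ℚᵘ.*≡* cross) (ℚᵘP.≃-sym (ℚP.toℚᵘ-homo-+ 1ℚ (ℕ→ℚ n))))
    where
    cross : ℤ.+ suc n ℤ.* ℤ.+ 1 ≡ (ℤ.+ 1 ℤ.* ℤ.+ 1 ℤ.+ ℤ.+ n ℤ.* ℤ.+ 1) ℤ.* ℤ.+ 1
    cross = trans (ℤP.*-identityʳ _) (sym (trans (ℤP.*-identityʳ _) (cong (ℤ._+_ (ℤ.+ 1)) (ℤP.*-identityʳ (ℤ.+ n)))))

  ℕ→ℚ-× : ∀ n → ℕ→ℚ n ≡ n Mult.× 1ℚ
  ℕ→ℚ-× zero    = refl
  ℕ→ℚ-× (suc n) = trans (ℕ→ℚ-suc n) (cong (1ℚ +_) (ℕ→ℚ-× n))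

  ℕ→ℚ-+ : ∀ m n → ℕ→ℚ (m ℕ.+ n) ≡ ℕ→ℚ m + ℕ→ℚ n
  ℕ→ℚ-+ m n = trans (ℕ→ℚ-× (m ℕ.+ n))
    (trans (Mult.×-homo-+ 1ℚ m n) (sym (cong₂ _+_ (ℕ→ℚ-× m) (ℕ→ℚ-× n))))

  ℕ→ℚ-* : ∀ m n → ℕ→ℚ (m ℕ.* n) ≡ ℕ→ℚ m * ℕ→ℚ n
  ℕ→ℚ-* m n = trans (ℕ→ℚ-× (m ℕ.* n))
    (trans (Mult.×1-homo-* m n) (sym (cong₂ _*_ (ℕ→ℚ-× m) (ℕ→ℚ-× n))))

  ℕ→ℚ-∑ : {A : Set} (xs : List A) (f : A → ℕ) → ℕ→ℚ (ℕΣ.∑ xs f) ≡ ℚΣ.∑ xs (ℕ→ℚ ∘ f)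
  ℕ→ℚ-∑ []       f = refl
  ℕ→ℚ-∑ (x ∷ xs) f = trans (ℕ→ℚ-+ (f x) _) (cong (ℕ→ℚ (f x) +_) (ℕ→ℚ-∑ xs f))

module ScaledE where

  open import Data.Nat as ℕ using (ℕ; zero; suc; _∸_; z≤n; s≤s)
  import Data.Nat.Properties as ℕP
  open import Data.Nat.Combinatorics using (_C_)
  open import Data.Fin as Fin using (Fin; toℕ; inject₁; fromℕ)
  import Data.Fin.Properties as FinP
  open import Data.Vec as Vec using (Vec; []; _∷_; lookup; _∷ʳ_)
  import Data.Vec.Properties as VecP
  open import Data.Rational as ℚ using (ℚ; 0ℚ; 1ℚ; _+_; _*_; _-_; _≟_)
  open import Data.Rational.Base using (≢-nonZero)
  import Data.Rational.Properties as ℚP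
  open import Data.Rational.Solver using (module +-*-Solver)
  open +-*-Solver
  open import Data.Empty using (⊥-elim)
  open import Function using (_∘_)
  open import Relation.Nullary using (yes; no; ¬_)
  open import Relation.Binary.PropositionalEquality
  open ≡-Reasoning
  open import Defs

  private variable
    A : Set
    n : ℕ

  AvoidsOne : (ℕ → ℚ) → Set
  AvoidsOne μ = ∀ i → 1 ℕ.≤ i → ¬ (μ i ≡ 1ℚ)

  Σ<-cong : ∀ n {f g : Fin n → ℚ} → (∀ k → f k ≡ g k) → Σ< n f ≡ Σ< n g
  Σ<-cong zero    f≡g = refl
  Σ<-cong (suc n) f≡g = cong₂ _+_ (f≡g Fin.zero) (Σ<-cong n (f≡g ∘ Fin.suc))

  *-distribˡ-Σ< : ∀ n c (f : Fin n → ℚ) → c * Σ< n f ≡ Σ< n (λ k → c * f k)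
  *-distribˡ-Σ< zero    c f = ℚP.*-zeroʳ c
  *-distribˡ-Σ< (suc n) c f = trans (ℚP.*-distribˡ-+ c _ _) (cong (c * f Fin.zero +_) (*-distribˡ-Σ< n c (f ∘ Fin.suc)))

  *-distribʳ-Σ< : ∀ n c (f : Fin n → ℚ) → Σ< n f * c ≡ Σ< n (λ k → f k * c)
  *-distribʳ-Σ< n c f = trans (ℚP.*-comm _ c) (trans (*-distribˡ-Σ< n c f) (Σ<-cong n (λ k → ℚP.*-comm c (f k))))

  Σ<-init-last : ∀ n (f : Fin (suc n) → ℚ) → Σ< (suc n) f ≡ Σ< n (f ∘ inject₁) + f (fromℕ n)
  Σ<-init-last zero    f = trans (ℚP.+-identityʳ (f Fin.zero)) (sym (ℚP.+-identityˡ (f Fin.zero)))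
  Σ<-init-last (suc n) f = trans (cong (f Fin.zero +_) (Σ<-init-last n (f ∘ Fin.suc))) (sym (ℚP.+-assoc (f Fin.zero) _ _))

  Π-after : (ℕ → ℚ) → ℕ → ℕ → ℚ
  Π-after μ a zero    = 1ℚ
  Π-after μ a (suc d) = Π-after μ a d * (1ℚ - μ (suc (a ℕ.+ d)))

  Π1-+ : ∀ μ a d → Π1 (a ℕ.+ d) (λ i → 1ℚ - μ i) ≡ Π1 a (λ i → 1ℚ - μ i) * Π-after μ a d
  Π1-+ μ a zero    = trans (cong (λ m → Π1 m (λ i → 1ℚ - μ i)) (ℕP.+-identityʳ a)) (sym (ℚP.*-identityʳ _))
  Π1-+ μ a (suc d) = begin
    Π1 (a ℕ.+ suc d) g                          ≡⟨ cong (λ m → Π1 m g) (ℕP.+-suc a d) ⟩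
    Π1 (a ℕ.+ d) g * g (suc (a ℕ.+ d))          ≡⟨ cong (_* g (suc (a ℕ.+ d))) (Π1-+ μ a d) ⟩
    Π1 a g * Π-after μ a d * g (suc (a ℕ.+ d))  ≡⟨ ℚP.*-assoc (Π1 a g) _ _ ⟩
    Π1 a g * Π-after μ a (suc d)                ∎
    where
    g = λ i → 1ℚ - μ i

  inv-inverseʳ : ∀ q → ¬ (q ≡ 0ℚ) → q * inv q ≡ 1ℚ
  inv-inverseʳ q q≢0 with q ≟ 0ℚ
  ... | yes q≡0 = ⊥-elim (q≢0 q≡0)
  ... | no q≢0′ = ℚP.*-inverseʳ q {{≢-nonZero q≢0′}}

  1-x≢0 : ∀ x → ¬ (x ≡ 1ℚ) → ¬ (1ℚ - x ≡ 0ℚ)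
  1-x≢0 x x≢1 1-x≡0 = x≢1 (trans (x≡1-[1-x] x) (cong (1ℚ -_) 1-x≡0))
    where
    x≡1-[1-x] : ∀ x → x ≡ 1ℚ - (1ℚ - x)
    x≡1-[1-x] = solve 1 (λ x → x := con 1ℚ :- (con 1ℚ :- x)) refl

  lookup-∷ʳ-table : (f : ℕ → A) (xs : Vec A n) → (∀ i → lookup xs i ≡ f (toℕ i)) →
                    ∀ {x} → x ≡ f n → ∀ i → lookup (xs ∷ʳ x) i ≡ f (toℕ i)
  lookup-∷ʳ-table f []       _       x≡fn Fin.zero    = x≡fn
  lookup-∷ʳ-table f (y ∷ ys) xs≡f    _    Fin.zero    = xs≡f Fin.zero
  lookup-∷ʳ-table f (y ∷ ys) xs≡f    x≡fn (Fin.suc i) = lookup-∷ʳ-table (f ∘ suc) ys (xs≡f ∘ Fin.suc) x≡fn i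

  e-suc : ∀ μ p → e μ (suc p) ≡
          inv (1ℚ - μ (suc p)) * Σ< (suc p) (λ k → ℕ→ℚ (suc p C toℕ k) * μ₀ μ (toℕ k) * lookup (es μ p) k)
  e-suc μ p = VecP.last-∷ʳ _ (es μ p)

  lookup-es : ∀ μ p (k : Fin (suc p)) → lookup (es μ p) k ≡ e μ (toℕ k)
  lookup-es μ zero    Fin.zero = refl
  lookup-es μ (suc p) k        = lookup-∷ʳ-table (e μ) (es μ p) (lookup-es μ p) (sym (e-suc μ p)) k

  scaledE : (ℕ → ℚ) → ℕ → ℚ
  scaledE μ p = Π1 p (λ i → 1ℚ - μ i) * e μ p

  -- with r = 0, the summands of the recursion for scaledE
  term : (ℕ → ℚ) → (ℕ → ℚ) → ℕ → ℕ → Fin n → ℚ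
  term μ Z m r k = ℕ→ℚ (suc (m ℕ.+ r) C toℕ k) * μ₀ μ (toℕ k) * Z (toℕ k) * Π-after μ (toℕ k) (m ∸ toℕ k)

  scaledE-suc : ∀ μ → AvoidsOne μ → ∀ m → scaledE μ (suc m) ≡ Σ< (suc m) (term μ (scaledE μ) m 0)
  scaledE-suc μ μ≢1 m = begin
    Π1 m g * (1ℚ - μ (suc m)) * e μ (suc m)          ≡⟨ cong (Π1 m g * (1ℚ - μ (suc m)) *_) (e-suc μ m) ⟩
    Π1 m g * (1ℚ - μ (suc m)) * (inv (1ℚ - μ (suc m)) * S)
                                                     ≡⟨ regroup (Π1 m g) (1ℚ - μ (suc m)) _ S ⟩
    Π1 m g * S * ((1ℚ - μ (suc m)) * inv (1ℚ - μ (suc m)))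
                                                     ≡⟨ cong (Π1 m g * S *_) (inv-inverseʳ _ 1-μ≢0) ⟩
    Π1 m g * S * 1ℚ                                  ≡⟨ ℚP.*-identityʳ _ ⟩
    Π1 m g * S                                       ≡⟨ *-distribˡ-Σ< (suc m) (Π1 m g) summand ⟩
    Σ< (suc m) (λ k → Π1 m g * summand k)            ≡⟨ Σ<-cong (suc m) to-term ⟩
    Σ< (suc m) (term μ (scaledE μ) m 0)              ∎
    where
    1-μ≢0 : ¬ (1ℚ - μ (suc m) ≡ 0ℚ)
    1-μ≢0 = 1-x≢0 _ (μ≢1 (suc m) (s≤s z≤n))
    g = λ i → 1ℚ - μ i
    summand : Fin (suc m) → ℚ
    summand k = ℕ→ℚ (suc m C toℕ k) * μ₀ μ (toℕ k) * lookup (es μ m) k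
    S = Σ< (suc m) summand
    regroup : ∀ a b c s → a * b * (c * s) ≡ a * s * (b * c)
    regroup = solve 4 (λ a b c s → a :* b :* (c :* s) := a :* s :* (b :* c)) refl
    regroup′ : ∀ P Q c u x → P * Q * (c * u * x) ≡ c * u * (P * x) * Q
    regroup′ = solve 5 (λ P Q c u x → P :* Q :* (c :* u :* x) := c :* u :* (P :* x) :* Q) refl
    to-term : ∀ k → Π1 m g * summand k ≡ term μ (scaledE μ) m 0 k
    to-term k = begin
      Π1 m g * summand k
        ≡⟨ cong₂ (λ P x → P * (ℕ→ℚ (suc m C j) * μ₀ μ j * x))
             (trans (cong (λ l → Π1 l g) (sym (ℕP.m+[n∸m]≡n j≤m))) (Π1-+ μ j (m ∸ j))) (lookup-es μ m k) ⟩
      Π1 j g * Π-after μ j (m ∸ j) * (ℕ→ℚ (suc m C j) * μ₀ μ j * e μ j)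
        ≡⟨ regroup′ (Π1 j g) (Π-after μ j (m ∸ j)) (ℕ→ℚ (suc m C j)) (μ₀ μ j) (e μ j) ⟩
      ℕ→ℚ (suc m C j) * μ₀ μ j * scaledE μ j * Π-after μ j (m ∸ j)
        ≡⟨ cong (λ l → ℕ→ℚ (suc l C j) * μ₀ μ j * scaledE μ j * Π-after μ j (m ∸ j)) (ℕP.+-identityʳ m) ⟨
      term μ (scaledE μ) m 0 k ∎
      where
      j = toℕ k
      j≤m : j ℕ.≤ m
      j≤m = ℕP.≤-pred (FinP.toℕ<n k)

module GeneratingFunction where

  open import Data.Nat as ℕ using (ℕ; zero; suc; _∸_; s≤s)
  import Data.Nat.Properties as ℕP
  open import Data.Nat.Combinatorics using (_C_)
  open import Data.Fin as Fin using (toℕ; inject₁; fromℕ)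
  import Data.Fin.Properties as FinP
  open import Data.Bool using (Bool; true; false; if_then_else_; T)
  open import Data.List as List using (List; []; _∷_; _++_; length)
  import Data.List.Properties as ListP
  open import Data.Vec as Vec using (Vec; []; _∷_; _∷ʳ_; toList)
  import Data.Vec.Properties as VecP
  open import Data.Rational as ℚ using (ℚ; 0ℚ; 1ℚ; _+_; _*_; _-_)
  import Data.Rational.Properties as ℚP
  open import Data.Rational.Solver using (module +-*-Solver)
  open +-*-Solver
  open import Data.Unit using (tt)
  open import Function using (_∘_)
  open import Relation.Binary.PropositionalEquality
  open ≡-Reasoning
  open import Defs
  open NatCast
  open ℚΣ
  open DescentSets using (bools; 𝟙[_⊆_]; ∑-⊆-numDesc)
  open IncreasingRuns using (αᴸ; αᴸ-toList; run; allowedᴸ; αᴸ-++-run)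
  open ScaledE
  open import Algebra.Properties.CommutativeSemigroup
    (Algebra.CommutativeMonoid.commutativeSemigroup ℚP.*-1-commutativeMonoid) using (x∙yz≈y∙xz; x∙yz≈z∙yx; x∙yz≈z∙xy)
  open import Algebra.Properties.CommutativeSemigroup
    (Algebra.CommutativeMonoid.commutativeSemigroup ℚP.+-0-commutativeMonoid) using (interchange)

  private variable n : ℕ

  weight : (ℕ → ℚ) → Vec Bool n → ℚ
  weight μ []      = 1ℚ
  weight μ (u ∷ U) = (if u then μ 1 else 1ℚ - μ 1) * weight (μ ∘ suc) U

  sumBool-head : ∀ n f → sumBool (suc n) f ≡ sumBool n (λ U → f (false ∷ U)) + sumBool n (λ U → f (true ∷ U))
  sumBool-head n f = begin
    sumBool (suc n) f
      ≡⟨ ∑-concatMap (λ b → List.map (b ∷_) (bools n)) (false ∷ true ∷ []) f ⟩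
    ∑ (List.map (false ∷_) (bools n)) f + (∑ (List.map (true ∷_) (bools n)) f + 0ℚ)
      ≡⟨ cong₂ _+_ (∑-map (false ∷_) (bools n) f) (trans (ℚP.+-identityʳ _) (∑-map (true ∷_) (bools n) f)) ⟩
    sumBool n (λ U → f (false ∷ U)) + sumBool n (λ U → f (true ∷ U)) ∎

  -- μ^S expands as ∏_{i ∈ S} μ_i ∏_{i ∉ S} (μ_i + (1 - μ_i))
  ∑-⊇-weight : ∀ n μ (S : Vec Bool n) →
               sumBool n (λ U → ℕ→ℚ 𝟙[ S ⊆ U ] * weight μ U) ≡ monomial μ S
  ∑-⊇-weight zero    μ []      = refl
  ∑-⊇-weight (suc n) μ (s ∷ S) =
    trans (sumBool-head n _)
      (trans (cong₂ _+_ (pull (1ℚ - μ 1) (λ U → ℕ→ℚ 𝟙[ s ∷ S ⊆ false ∷ U ]))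
                        (pull (μ 1) (λ U → ℕ→ℚ 𝟙[ s ∷ S ⊆ true ∷ U ])))
             (by-head s))
    where
    w = weight (μ ∘ suc)
    M = monomial (μ ∘ suc) S
    pull : ∀ c (f : Vec Bool n → ℚ) → sumBool n (λ U → f U * (c * w U)) ≡ c * sumBool n (λ U → f U * w U)
    pull c f = trans (∑-cong (bools n) (λ U → x∙yz≈y∙xz (f U) c (w U))) (sym (*-distribˡ-∑ (bools n) c _))
    by-head : ∀ s → (1ℚ - μ 1) * sumBool n (λ U → ℕ→ℚ 𝟙[ s ∷ S ⊆ false ∷ U ] * w U)
                    + μ 1 * sumBool n (λ U → ℕ→ℚ 𝟙[ s ∷ S ⊆ true ∷ U ] * w U) ≡ monomial μ (s ∷ S)
    by-head false = begin
      (1ℚ - μ 1) * sumBool n (λ U → ℕ→ℚ 𝟙[ S ⊆ U ] * w U) + μ 1 * sumBool n (λ U → ℕ→ℚ 𝟙[ S ⊆ U ] * w U)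
        ≡⟨ cong (λ x → (1ℚ - μ 1) * x + μ 1 * x) (∑-⊇-weight n (μ ∘ suc) S) ⟩
      (1ℚ - μ 1) * M + μ 1 * M ≡⟨ [1-a]m+am≡1m (μ 1) M ⟩
      1ℚ * M ∎
      where
      [1-a]m+am≡1m : ∀ a m → (1ℚ - a) * m + a * m ≡ 1ℚ * m
      [1-a]m+am≡1m = solve 2 (λ a m → (con 1ℚ :- a) :* m :+ a :* m := con 1ℚ :* m) refl
    by-head true = begin
      (1ℚ - μ 1) * sumBool n (λ U → 0ℚ * w U) + μ 1 * sumBool n (λ U → ℕ→ℚ 𝟙[ S ⊆ U ] * w U)
        ≡⟨ cong₂ (λ x y → (1ℚ - μ 1) * x + μ 1 * y)
             (trans (∑-cong (bools n) (λ U → ℚP.*-zeroˡ (w U))) (∑-zero (bools n))) (∑-⊇-weight n (μ ∘ suc) S) ⟩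
      (1ℚ - μ 1) * 0ℚ + μ 1 * M ≡⟨ cong (_+ μ 1 * M) (ℚP.*-zeroʳ (1ℚ - μ 1)) ⟩
      0ℚ + μ 1 * M ≡⟨ ℚP.+-identityˡ _ ⟩
      μ 1 * M ∎

  weightedRuns : (ℕ → ℚ) → ℕ → ℕ → ℚ
  weightedRuns μ m r = sumBool m (λ T → ℕ→ℚ (αᴸ (toList T ++ run r)) * weight μ T)

  numDesc-expansion : ∀ n μ → sumBool n (λ S → ℕ→ℚ (numDesc S) * monomial μ S) ≡ weightedRuns μ n 0
  numDesc-expansion n μ = begin
    sumBool n (λ S → β S * monomial μ S)
      ≡⟨ ∑-cong (bools n) (λ S → trans (cong (β S *_) (sym (∑-⊇-weight n μ S))) (*-distribˡ-∑ (bools n) (β S) _)) ⟩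
    sumBool n (λ S → sumBool n (λ U → β S * (ℕ→ℚ 𝟙[ S ⊆ U ] * weight μ U)))
      ≡⟨ ∑-comm (bools n) (bools n) _ ⟩
    sumBool n (λ U → sumBool n (λ S → β S * (ℕ→ℚ 𝟙[ S ⊆ U ] * weight μ U)))
      ≡⟨ ∑-cong (bools n) (λ U → trans (∑-cong (bools n) (λ S → x∙yz≈z∙yx (β S) (ℕ→ℚ 𝟙[ S ⊆ U ]) (weight μ U)))
                                        (sym (*-distribˡ-∑ (bools n) (weight μ U) _))) ⟩
    sumBool n (λ U → weight μ U * sumBool n (λ S → ℕ→ℚ 𝟙[ S ⊆ U ] * β S))
      ≡⟨ ∑-cong (bools n) (λ U → cong (weight μ U *_) (count U)) ⟩
    sumBool n (λ U → weight μ U * ℕ→ℚ (αᴸ (toList U ++ run 0)))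
      ≡⟨ ∑-cong (bools n) (λ U → ℚP.*-comm (weight μ U) _) ⟩
    weightedRuns μ n 0 ∎
    where
    β : Vec Bool n → ℚ
    β S = ℕ→ℚ (numDesc S)
    count : ∀ U → sumBool n (λ S → ℕ→ℚ 𝟙[ S ⊆ U ] * β S) ≡ ℕ→ℚ (αᴸ (toList U ++ run 0))
    count U = begin
      sumBool n (λ S → ℕ→ℚ 𝟙[ S ⊆ U ] * β S)
        ≡⟨ ∑-cong (bools n) (λ S → ℕ→ℚ-* 𝟙[ S ⊆ U ] (numDesc S)) ⟨
      ∑ (bools n) (λ S → ℕ→ℚ (𝟙[ S ⊆ U ] ℕ.* numDesc S))
        ≡⟨ ℕ→ℚ-∑ (bools n) _ ⟨
      ℕ→ℚ (Counting.∑ (bools n) (λ S → 𝟙[ S ⊆ U ] ℕ.* numDesc S))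
        ≡⟨ cong ℕ→ℚ (∑-⊆-numDesc U) ⟩
      ℕ→ℚ (MinimumRemoval.α (U ∷ʳ true))
        ≡⟨ cong ℕ→ℚ (trans (sym (αᴸ-toList (U ∷ʳ true))) (cong αᴸ (VecP.toList-∷ʳ true U))) ⟩
      ℕ→ℚ (αᴸ (toList U ++ run 0)) ∎

  sumBool-last : ∀ n f → sumBool (suc n) f ≡ sumBool n (λ U → f (U ∷ʳ false)) + sumBool n (λ U → f (U ∷ʳ true))
  sumBool-last zero    f = sumBool-head zero f
  sumBool-last (suc n) f = begin
    sumBool (suc (suc n)) f
      ≡⟨ sumBool-head (suc n) f ⟩
    sumBool (suc n) (λ U → f (false ∷ U)) + sumBool (suc n) (λ U → f (true ∷ U))
      ≡⟨ cong₂ _+_ (sumBool-last n (λ U → f (false ∷ U))) (sumBool-last n (λ U → f (true ∷ U))) ⟩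
    (part false false + part false true) + (part true false + part true true)
      ≡⟨ interchange (part false false) (part false true) (part true false) (part true true) ⟩
    (part false false + part true false) + (part false true + part true true)
      ≡⟨ cong₂ _+_ (sumBool-head n (λ U → f (U ∷ʳ false))) (sumBool-head n (λ U → f (U ∷ʳ true))) ⟨
    sumBool (suc n) (λ U → f (U ∷ʳ false)) + sumBool (suc n) (λ U → f (U ∷ʳ true)) ∎
    where
    part : Bool → Bool → ℚ
    part b c = sumBool n (λ U → f (b ∷ (U ∷ʳ c)))

  weight-∷ʳ : ∀ μ {m} (U : Vec Bool m) b → weight μ (U ∷ʳ b) ≡ weight μ U * (if b then μ (suc m) else 1ℚ - μ (suc m))
  weight-∷ʳ μ []      b = ℚP.*-comm (if b then μ 1 else 1ℚ - μ 1) 1ℚ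
  weight-∷ʳ μ {suc m} (u ∷ U) b = trans (cong (head *_) (weight-∷ʳ (μ ∘ suc) U b))
    (sym (ℚP.*-assoc head (weight (μ ∘ suc) U) (if b then μ (suc (suc m)) else 1ℚ - μ (suc (suc m)))))
    where
    head = if u then μ 1 else 1ℚ - μ 1

  allowedᴸ-end-∷ʳ-true : ∀ {m} (U : Vec Bool m) → T (allowedᴸ (toList (U ∷ʳ true)) (suc m))
  allowedᴸ-end-∷ʳ-true []      = tt
  allowedᴸ-end-∷ʳ-true (u ∷ U) = allowedᴸ-end-∷ʳ-true U

  weightedRuns-zero : ∀ μ r → weightedRuns μ 0 r ≡ 1ℚ
  weightedRuns-zero μ r = cong (λ x → ℕ→ℚ x * 1ℚ + 0ℚ) (αᴸ-++-run [] r tt)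

  -- split by the last entry of U: either it extends the run, or U ∷ʳ true starts a new one
  weightedRuns-suc : ∀ μ m r → weightedRuns μ (suc m) r ≡
                     (1ℚ - μ (suc m)) * weightedRuns μ m (suc r)
                     + μ (suc m) * (ℕ→ℚ (suc (suc m ℕ.+ r) C suc m) * weightedRuns μ m 0)
  weightedRuns-suc μ m r = begin
    weightedRuns μ (suc m) r
      ≡⟨ sumBool-last m _ ⟩
    sumBool m (λ U → F (U ∷ʳ false)) + sumBool m (λ U → F (U ∷ʳ true))
      ≡⟨ cong₂ _+_ (∑-cong (bools m) extend) (∑-cong (bools m) restart) ⟩
    sumBool m (λ U → (1ℚ - μ (suc m)) * G (suc r) U) + sumBool m (λ U → μ (suc m) * (c * G 0 U))
      ≡⟨ cong₂ _+_ (*-distribˡ-∑ (bools m) (1ℚ - μ (suc m)) (G (suc r)))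
                   (trans (cong (μ (suc m) *_) (*-distribˡ-∑ (bools m) c (G 0)))
                          (*-distribˡ-∑ (bools m) (μ (suc m)) (λ U → c * G 0 U))) ⟨
    (1ℚ - μ (suc m)) * weightedRuns μ m (suc r) + μ (suc m) * (c * weightedRuns μ m 0) ∎
    where
    F : Vec Bool (suc m) → ℚ
    F U = ℕ→ℚ (αᴸ (toList U ++ run r)) * weight μ U
    G : ℕ → Vec Bool m → ℚ
    G r U = ℕ→ℚ (αᴸ (toList U ++ run r)) * weight μ U
    c = ℕ→ℚ (suc (suc m ℕ.+ r) C suc m)
    extend : ∀ U → F (U ∷ʳ false) ≡ (1ℚ - μ (suc m)) * G (suc r) U
    extend U = trans (cong₂ (λ l w → ℕ→ℚ (αᴸ l) * w)
                       (trans (cong (_++ run r) (VecP.toList-∷ʳ false U)) (ListP.++-assoc (toList U) (false ∷ []) (run r)))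
                       (weight-∷ʳ μ U false))
                     (x∙yz≈z∙xy (ℕ→ℚ (αᴸ (toList U ++ run (suc r)))) (weight μ U) (1ℚ - μ (suc m)))
    restart : ∀ U → F (U ∷ʳ true) ≡ μ (suc m) * (c * G 0 U)
    restart U = begin
      ℕ→ℚ (αᴸ (W ++ run r)) * weight μ (U ∷ʳ true)
        ≡⟨ cong₂ (λ x w → ℕ→ℚ x * w) (αᴸ-++-run W r (subst (λ l → T (allowedᴸ W l)) (sym |W|≡) (allowedᴸ-end-∷ʳ-true U)))
                                     (weight-∷ʳ μ U true) ⟩
      ℕ→ℚ ((suc (length W ℕ.+ r) C length W) ℕ.* αᴸ W) * (weight μ U * μ (suc m))
        ≡⟨ cong (λ l → ℕ→ℚ ((suc (l ℕ.+ r) C l) ℕ.* αᴸ W) * (weight μ U * μ (suc m))) |W|≡ ⟩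
      ℕ→ℚ ((suc (suc m ℕ.+ r) C suc m) ℕ.* αᴸ W) * (weight μ U * μ (suc m))
        ≡⟨ cong (_* (weight μ U * μ (suc m))) (ℕ→ℚ-* (suc (suc m ℕ.+ r) C suc m) (αᴸ W)) ⟩
      c * ℕ→ℚ (αᴸ W) * (weight μ U * μ (suc m))
        ≡⟨ regroup c (ℕ→ℚ (αᴸ W)) (weight μ U) (μ (suc m)) ⟩
      μ (suc m) * (c * (ℕ→ℚ (αᴸ W) * weight μ U))
        ≡⟨ cong (λ l → μ (suc m) * (c * (ℕ→ℚ (αᴸ l) * weight μ U))) (VecP.toList-∷ʳ true U) ⟩
      μ (suc m) * (c * G 0 U) ∎
      where
      W = toList (U ∷ʳ true)
      |W|≡ : length W ≡ suc m
      |W|≡ = VecP.length-toList (U ∷ʳ true)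
      regroup : ∀ c a w x → c * a * (w * x) ≡ x * (c * (a * w))
      regroup = solve 4 (λ c a w x → c :* a :* (w :* x) := x :* (c :* (a :* w))) refl

  -- equals ∑_S β(S) μ^S for p = n + 1 (numDesc-expansion)
  descentPolynomial : (ℕ → ℚ) → ℕ → ℚ
  descentPolynomial μ zero    = 1ℚ
  descentPolynomial μ (suc m) = weightedRuns μ m 0

  weightedRuns-closed : ∀ μ m r → weightedRuns μ m r ≡ Σ< (suc m) (term μ (descentPolynomial μ) m r)
  weightedRuns-closed μ zero    r = weightedRuns-zero μ r
  weightedRuns-closed μ (suc m) r = begin
    weightedRuns μ (suc m) r
      ≡⟨ weightedRuns-suc μ m r ⟩
    (1ℚ - μ (suc m)) * weightedRuns μ m (suc r) + μ (suc m) * (c * X (suc m))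
      ≡⟨ cong (λ s → (1ℚ - μ (suc m)) * s + μ (suc m) * (c * X (suc m))) (weightedRuns-closed μ m (suc r)) ⟩
    (1ℚ - μ (suc m)) * Σ< (suc m) (term μ X m (suc r)) + μ (suc m) * (c * X (suc m))
      ≡⟨ regroup (1ℚ - μ (suc m)) _ (μ (suc m)) c (X (suc m)) ⟩
    Σ< (suc m) (term μ X m (suc r)) * (1ℚ - μ (suc m)) + c * μ (suc m) * X (suc m) * 1ℚ
      ≡⟨ cong₂ _+_ (*-distribʳ-Σ< (suc m) (1ℚ - μ (suc m)) (term μ X m (suc r))) (sym last) ⟩
    Σ< (suc m) (λ k → term μ X m (suc r) k * (1ℚ - μ (suc m))) + term μ X (suc m) r (fromℕ (suc m))
      ≡⟨ cong (_+ term μ X (suc m) r (fromℕ (suc m))) (Σ<-cong (suc m) (λ k → sym (init k))) ⟩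
    Σ< (suc m) (term μ X (suc m) r ∘ inject₁) + term μ X (suc m) r (fromℕ (suc m))
      ≡⟨ Σ<-init-last (suc m) (term μ X (suc m) r) ⟨
    Σ< (suc (suc m)) (term μ X (suc m) r) ∎
    where
    X = descentPolynomial μ
    c = ℕ→ℚ (suc (suc m ℕ.+ r) C suc m)
    regroup : ∀ a s b c x → a * s + b * (c * x) ≡ s * a + c * b * x * 1ℚ
    regroup = solve 5 (λ a s b c x → a :* s :+ b :* (c :* x) := s :* a :+ c :* b :* x :* con 1ℚ) refl
    summand : ℕ → ℕ → ℕ → ℚ
    summand n j d = ℕ→ℚ (n C j) * μ₀ μ j * X j * Π-after μ j d
    last : term μ X (suc m) r (fromℕ (suc m)) ≡ c * μ (suc m) * X (suc m) * 1ℚ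
    last = trans (cong (λ j → summand (suc (suc m ℕ.+ r)) j (suc m ∸ j)) (FinP.toℕ-fromℕ (suc m)))
                 (cong (summand (suc (suc m ℕ.+ r)) (suc m)) (ℕP.n∸n≡0 m))
    init : ∀ k → term μ X (suc m) r (inject₁ k) ≡ term μ X m (suc r) k * (1ℚ - μ (suc m))
    init k = begin
      summand (suc (suc m ℕ.+ r)) (toℕ (inject₁ k)) (suc m ∸ toℕ (inject₁ k))
        ≡⟨ cong (λ j → summand (suc (suc m ℕ.+ r)) j (suc m ∸ j)) (FinP.toℕ-inject₁ k) ⟩
      summand (suc (suc m ℕ.+ r)) j (suc m ∸ j)
        ≡⟨ cong₂ (λ n d → summand n j d) (cong suc (sym (ℕP.+-suc m r))) (ℕP.+-∸-assoc 1 j≤m) ⟩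
      ℕ→ℚ (suc (m ℕ.+ suc r) C j) * μ₀ μ j * X j * (Π-after μ j (m ∸ j) * (1ℚ - μ (suc (j ℕ.+ (m ∸ j)))))
        ≡⟨ cong (λ i → ℕ→ℚ (suc (m ℕ.+ suc r) C j) * μ₀ μ j * X j * (Π-after μ j (m ∸ j) * (1ℚ - μ (suc i))))
                (ℕP.m+[n∸m]≡n j≤m) ⟩
      ℕ→ℚ (suc (m ℕ.+ suc r) C j) * μ₀ μ j * X j * (Π-after μ j (m ∸ j) * (1ℚ - μ (suc m)))
        ≡⟨ ℚP.*-assoc (ℕ→ℚ (suc (m ℕ.+ suc r) C j) * μ₀ μ j * X j) (Π-after μ j (m ∸ j)) (1ℚ - μ (suc m)) ⟨
      term μ X m (suc r) k * (1ℚ - μ (suc m)) ∎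
      where
      j = toℕ k
      j≤m : j ℕ.≤ m
      j≤m = ℕP.≤-pred (FinP.toℕ<n k)

  descentPolynomial≡scaledE : ∀ μ → AvoidsOne μ → ∀ p → descentPolynomial μ p ≡ scaledE μ p
  descentPolynomial≡scaledE μ μ≢1 p = up-to p p ℕP.≤-refl
    where
    up-to : ∀ b q → q ℕ.≤ b → descentPolynomial μ q ≡ scaledE μ q
    up-to _       zero    _         = refl
    up-to (suc b) (suc q) (s≤s q≤b) = begin
      weightedRuns μ q 0                           ≡⟨ weightedRuns-closed μ q 0 ⟩
      Σ< (suc q) (term μ (descentPolynomial μ) q 0) ≡⟨ Σ<-cong (suc q) same-terms ⟩
      Σ< (suc q) (term μ (scaledE μ) q 0)           ≡⟨ scaledE-suc μ μ≢1 q ⟨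
      scaledE μ (suc q)                            ∎
      where
      same-terms : ∀ k → term μ (descentPolynomial μ) q 0 k ≡ term μ (scaledE μ) q 0 k
      same-terms k = cong (λ z → ℕ→ℚ (suc (q ℕ.+ 0) C toℕ k) * μ₀ μ (toℕ k) * z * Π-after μ (toℕ k) (q ∸ toℕ k))
                          (up-to b (toℕ k) (ℕP.≤-trans (ℕP.≤-pred (FinP.toℕ<n k)) q≤b))

  numDesc-isExpansion : ∀ n → IsExpansion n (λ S → ℕ→ℚ (numDesc S))
  numDesc-isExpansion n μ μ≢1 = sym (trans (numDesc-expansion n μ) (descentPolynomial≡scaledE μ μ≢1 (suc n)))

module Uniqueness where

  open import Data.Nat as ℕ using (ℕ; zero; suc; s≤s; z≤n)
  open import Data.Bool using (Bool; true; false)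
  open import Data.Vec using (Vec; []; _∷_)
  open import Data.Rational as ℚ using (ℚ; 0ℚ; 1ℚ; _+_; _*_; _-_; -_)
  import Data.Rational.Properties as ℚP
  open import Data.Rational.Solver using (module +-*-Solver)
  open +-*-Solver
  open import Data.Product using (_×_; _,_; proj₁; proj₂)
  open import Relation.Nullary using (¬_)
  open import Relation.Binary.PropositionalEquality
  open ≡-Reasoning
  open import Defs using (sumBool; monomial; IsExpansion)
  open ℚΣ using (∑-cong; *-distribˡ-∑)
  open DescentSets using (bools)
  open ScaledE using (AvoidsOne)
  open GeneratingFunction using (sumBool-head)
  open import Algebra.Properties.CommutativeSemigroup
    (Algebra.CommutativeMonoid.commutativeSemigroup ℚP.*-1-commutativeMonoid) using (x∙yz≈y∙xz)

  withFirst : ℚ → (ℕ → ℚ) → ℕ → ℚ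
  withFirst c μ zero          = 0ℚ
  withFirst c μ (suc zero)    = c
  withFirst c μ (suc (suc i)) = μ (suc i)

  withFirst-avoidsOne : ∀ {c μ} → ¬ (c ≡ 1ℚ) → AvoidsOne μ → AvoidsOne (withFirst c μ)
  withFirst-avoidsOne c≢1 μ≢1 (suc zero)    _ = c≢1
  withFirst-avoidsOne c≢1 μ≢1 (suc (suc i)) _ = μ≢1 (suc i) (s≤s z≤n)

  -- a polynomial A₀ + c A₁ in c is determined by its values at c = 0 and c = -1
  linear-coefficients : ∀ {A₀ A₁ B₀ B₁} → (∀ c → ¬ (c ≡ 1ℚ) → A₀ + c * A₁ ≡ B₀ + c * B₁) → A₀ ≡ B₀ × A₁ ≡ B₁
  linear-coefficients {A₀} {A₁} {B₀} {B₁} agree = constant , slope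
    where
    0≢1 : ¬ (0ℚ ≡ 1ℚ)
    0≢1 ()
    -1≢1 : ¬ (- 1ℚ ≡ 1ℚ)
    -1≢1 ()
    at-0 : ∀ a b → a ≡ a + 0ℚ * b
    at-0 = solve 2 (λ a b → a := a :+ con 0ℚ :* b) refl
    difference : ∀ a b → b ≡ (a + 0ℚ * b) - (a + (- 1ℚ) * b)
    difference = solve 2 (λ a b → b := (a :+ con 0ℚ :* b) :- (a :+ (:- con 1ℚ) :* b)) refl
    constant : A₀ ≡ B₀
    constant = begin
      A₀              ≡⟨ at-0 A₀ A₁ ⟩
      A₀ + 0ℚ * A₁    ≡⟨ agree 0ℚ 0≢1 ⟩
      B₀ + 0ℚ * B₁    ≡⟨ at-0 B₀ B₁ ⟨
      B₀              ∎
    slope : A₁ ≡ B₁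
    slope = begin
      A₁                                     ≡⟨ difference A₀ A₁ ⟩
      (A₀ + 0ℚ * A₁) - (A₀ + (- 1ℚ) * A₁)    ≡⟨ cong₂ _-_ (agree 0ℚ 0≢1) (agree (- 1ℚ) -1≢1) ⟩
      (B₀ + 0ℚ * B₁) - (B₀ + (- 1ℚ) * B₁)    ≡⟨ difference B₀ B₁ ⟨
      B₁                                     ∎

  sumBool-withFirst : ∀ n (a : Vec Bool (suc n) → ℚ) c μ →
    sumBool (suc n) (λ j → a j * monomial (withFirst c μ) j)
    ≡ sumBool n (λ j → a (false ∷ j) * monomial μ j) + c * sumBool n (λ j → a (true ∷ j) * monomial μ j)
  sumBool-withFirst n a c μ = trans (sumBool-head n _) (cong₂ _+_
    (∑-cong (bools n) (λ j → cong (a (false ∷ j) *_) (ℚP.*-identityˡ (monomial μ j))))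
    (trans (∑-cong (bools n) (λ j → x∙yz≈y∙xz (a (true ∷ j)) c (monomial μ j)))
           (sym (*-distribˡ-∑ (bools n) c (λ j → a (true ∷ j) * monomial μ j)))))

  Agree : ∀ n → (Vec Bool n → ℚ) → (Vec Bool n → ℚ) → Set
  Agree n a b = ∀ μ → AvoidsOne μ → sumBool n (λ j → a j * monomial μ j) ≡ sumBool n (λ j → b j * monomial μ j)

  agree-by-first : ∀ n (a b : Vec Bool (suc n) → ℚ) → Agree (suc n) a b →
                   Agree n (λ j → a (false ∷ j)) (λ j → b (false ∷ j)) ×
                   Agree n (λ j → a (true ∷ j)) (λ j → b (true ∷ j))
  agree-by-first n a b a≈b = (λ μ μ≢1 → proj₁ (by-μ₁ μ μ≢1)) , (λ μ μ≢1 → proj₂ (by-μ₁ μ μ≢1))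
    where
    part : (Vec Bool (suc n) → ℚ) → Bool → (ℕ → ℚ) → ℚ
    part a x μ = sumBool n (λ j → a (x ∷ j) * monomial μ j)
    by-μ₁ : ∀ μ → AvoidsOne μ → part a false μ ≡ part b false μ × part a true μ ≡ part b true μ
    by-μ₁ μ μ≢1 = linear-coefficients λ c c≢1 →
      trans (sym (sumBool-withFirst n a c μ))
            (trans (a≈b (withFirst c μ) (withFirst-avoidsOne c≢1 μ≢1)) (sumBool-withFirst n b c μ))

  coefficients-unique : ∀ n (a b : Vec Bool n → ℚ) → Agree n a b → ∀ j → a j ≡ b j
  coefficients-unique zero    a b a≈b [] = begin
    a []              ≡⟨ x≡x*1+0 (a []) ⟩
    a [] * 1ℚ + 0ℚ    ≡⟨ a≈b (λ _ → 0ℚ) (λ _ _ ()) ⟩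
    b [] * 1ℚ + 0ℚ    ≡⟨ x≡x*1+0 (b []) ⟨
    b []              ∎
    where
    x≡x*1+0 : ∀ x → x ≡ x * 1ℚ + 0ℚ
    x≡x*1+0 = solve 1 (λ x → x := x :* con 1ℚ :+ con 0ℚ) refl
  coefficients-unique (suc n) a b a≈b (false ∷ j) =
    coefficients-unique n (λ j → a (false ∷ j)) (λ j → b (false ∷ j)) (proj₁ (agree-by-first n a b a≈b)) j
  coefficients-unique (suc n) a b a≈b (true ∷ j) =
    coefficients-unique n (λ j → a (true ∷ j)) (λ j → b (true ∷ j)) (proj₂ (agree-by-first n a b a≈b)) j

  expansion-unique : ∀ n {a b} → IsExpansion n a → IsExpansion n b → ∀ j → a j ≡ b j
  expansion-unique n {a} {b} a-expansion b-expansion =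
    coefficients-unique n a b (λ μ μ≢1 → trans (sym (a-expansion μ μ≢1)) (b-expansion μ μ≢1))

open GeneratingFunction using (numDesc-isExpansion)
open Uniqueness using (expansion-unique)

theorem1 : (n : ℕ) →
    IsExpansion n (λ j → ℕ→ℚ (numDesc j)) ×
    ((a : Vec Bool n → ℚ) → IsExpansion n a → (j : Vec Bool n) → a j ≡ ℕ→ℚ (numDesc j))
theorem1 n = numDesc-isExpansion n , λ a a-expansion → expansion-unique n a-expansion (numDesc-isExpansion n)
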